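{- For every integer $n\ge 1$, as an identity of polynomials in $x_0,\dots,x_n,y_0,\dots,y_n$, $$\det H_n(x_0,\dots,x_n,y_0,\dots,y_n)=\det\begin{bmatrix} x_n+y_n & (-1)^n x_n\,U_n^T\\ y_n\,U_n & H_{n-1}(x_0,\dots,x_{n-1},y_0,\dots,y_{n-1})\end{bmatrix},$$ where the matrix on the right has size $n^2+1$ and $U_n\in\mathbb R^{n^2}$ is the vector whose first $(n-1)^2$ components are $0$, followed by the $2n-1$ components $1,0,-1,0,1,0,-1,\dots$ (the component in position $(n-1)^2+j$, $1\le j\le 2n-1$, being $0$ for $j$ even and $(-1)^{(j-1)/2}$ for $j$ odd).
   Context: For an integer $m\ge 0$ and parameters $x_m,y_m$, let $T_0(x_0,y_0)$ be the $1\times 1$ matrix $(x_0+y_0)$. For $m\ge 1$, let $T_m(x_m,y_m)$ be the $(2m+1)\times(2m+1)$ matrix with entries equal to $1$ in positions $(i,i+1)$ and $(i+1,i)$ for $1\le i\le 2m$, entry $y_m$ in position $(1,2m+1)$, entry $x_m$ in position $(2m+1,1)$, and $0$ elsewhere. For $m\ge 1$, let $R_m$ be the $(2m+1)\times(2m-1)$ matrix with $(R_m)_{i,j}=1$ if $j$ is odd and $i=j+1$, and $(R_m)_{i,j}=0$ otherwise. For $n\ge 0$, $H_n(x_0,\dots,x_n,y_0,\dots,y_n)$ is the block tridiagonal matrix of size $(n+1)^2$ whose diagonal blocks are $T_0(x_0,y_0),\dots,T_n(x_n,y_n)$, whose block in position $(m,m-1)$ is $R_m$ and in position $(m-1,m)$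 is $R_m^T$ ($1\le m\le n$), all other blocks being zero. -}

module Defs where

open import Level using (Level)
open import Data.Nat as ℕ using (ℕ; zero; suc; _∸_; _≡ᵇ_; _<ᵇ_)
open import Data.Bool using (Bool; true; false; if_then_else_; _∧_; _∨_)
open import Data.Product using (_×_; _,_)
open import Data.Fin using (Fin; toℕ; punchIn)
open import Algebra.Bundles using (CommutativeRing)

evenᵇ : ℕ → Bool
evenᵇ zero = true
evenᵇ (suc zero) = false
evenᵇ (suc (suc n)) = evenᵇ n

-- Block coordinates of a 0-based global index i of H_n:
-- pos i = (m , k) with i = m² + k and 0 ≤ k ≤ 2m
-- (i lies in the diagonal block T_m, at 0-based offset k).
pos : ℕ → ℕ × ℕ
pos zero = 0 , 0
pos (suc i) with pos i
... | m , k = if k ≡ᵇ (2 ℕ.* m) then (suc m , 0) else (m , suc k)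

module _ {c ℓ : Level} (R : CommutativeRing c ℓ) where
  open CommutativeRing R renaming (Carrier to A)

  sgn : ℕ → A
  sgn zero = 1#
  sgn (suc n) = - sgn n

  sumFin : (n : ℕ) → (Fin n → A) → A
  sumFin zero f = 0#
  sumFin (suc n) f = f Fin.zero + sumFin n (λ j → f (Fin.suc j))

  det : (n : ℕ) → (Fin n → Fin n → A) → A
  det zero M = 1#
  det (suc n) M =
    sumFin (suc n) (λ j → sgn (toℕ j) * (M Fin.zero j *
      det n (λ a b → M (Fin.suc a) (punchIn j b))))

  -- Entry (k,l) (0-based) of the diagonal block T_m(x_m, y_m).
  tEntry : (x y : ℕ → A) → ℕ → ℕ → ℕ → A
  tEntry x y zero k l = x 0 + y 0
  tEntry x y (suc m) k l =
    if (k ≡ᵇ suc l) ∨ (l ≡ᵇ suc k) then 1#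
    else if (k ≡ᵇ 0) ∧ (l ≡ᵇ 2 ℕ.* suc m) then y (suc m)
    else if (k ≡ᵇ 2 ℕ.* suc m) ∧ (l ≡ᵇ 0) then x (suc m)
    else 0#

  -- Entry (k,l) (0-based) of R_m: (R_m)_{i,j} = 1 iff j odd and i = j+1 (1-based).
  rEntry : ℕ → ℕ → A
  rEntry k l = if (k ≡ᵇ suc l) ∧ evenᵇ l then 1# else 0#

  -- Entry (i,j) (0-based global indices) of the block tridiagonal matrix H.
  -- (The entries do not depend on n; H_n is the leading (n+1)²×(n+1)² part.)
  hEntry : (x y : ℕ → A) → ℕ → ℕ → A
  hEntry x y i j with pos i | pos j
  ... | m , k | m' , l =
    if m ≡ᵇ m' then tEntry x y m k l
    else if m ≡ᵇ suc m' then rEntry k l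
    else if suc m ≡ᵇ m' then rEntry l k
    else 0#

  H : (n : ℕ) → (x y : ℕ → A) → Fin (suc n ℕ.* suc n) → Fin (suc n ℕ.* suc n) → A
  H n x y i j = hEntry x y (toℕ i) (toℕ j)

  ualt : ℕ → A
  ualt zero = 1#
  ualt (suc zero) = 0#
  ualt (suc (suc j)) = - ualt j

  -- Component t (0-based) of U_n ∈ A^{n²}.
  U : ℕ → ℕ → A
  U n t = if t <ᵇ (n ∸ 1) ℕ.* (n ∸ 1) then 0#
          else ualt (t ∸ (n ∸ 1) ℕ.* (n ∸ 1))

  rhsEntry : ℕ → (x y : ℕ → A) → ℕ → ℕ → A
  rhsEntry n x y zero zero = x n + y n
  rhsEntry n x y zero (suc j) = (sgn n * x n) * U n j
  rhsEntry n x y (suc i) zero = y n * U n i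
  rhsEntry n x y (suc i) (suc j) = hEntry x y i j

  Border : (n : ℕ) → (x y : ℕ → A) → Fin (suc (n ℕ.* n)) → Fin (suc (n ℕ.* n)) → A
  Border n x y i j = rhsEntry n x y (toℕ i) (toℕ j)

{-# OPTIONS --safe #-}
-- Write P = n², so that H_n is H_{n-1} (indices below P) bordered by the block T_n(x_n, y_n),
-- a cycle on the indices P, ..., P + 2n whose vertices P + 1, P + 3, ..., P + 2n - 1 are joined
-- to the last block of H_{n-1} through R_n. More generally attach to H_{n-1}, through R_n, a cycle
-- T_k(a, b) whose first vertex is moreover joined to H_{n-1} by a·V_k and b·V_k, where V_k is
-- U_n shifted by 2k (V_n vanishes on H_{n-1}, V_0 = U_n). The last two vertices of the cycle
-- can be eliminated: subtract a times the penultimate column from column P, swap the last two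
-- columns and expand along the last row, then subtract the new last column from columns
-- P + 2k - 2 and (n-1)² + 2k - 2 and expand again. As V_{k-1} + V_k is the unit vector at
-- (n-1)² + 2k - 2, what remains is the matrix of the same kind for k - 1 with a, b replaced by
-- -a, -b, at the cost of a sign. After n steps one vertex is left; moved to the front, its
-- determinant and that of the bordered matrix of the statement both expand to
-- (x_n + y_n) det H_{n-1} + (-1)^n x_n y_n det [[0, U_nᵀ], [U_n, H_{n-1}]].

module Submission where

open import Defs
open import Level using (Level)
open import Algebra.Bundles using (CommutativeRing)
open import Data.Bool using (true; false; if_then_else_)
open import Data.Nat using (ℕ; zero; suc; _<_; _≤_; _∸_; z≤n; s≤s; _≡ᵇ_; _<ᵇ_; _≟_)
  renaming (_+_ to _+ℕ_; _*_ to _*ℕ_)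
import Data.Nat.Properties as ℕ
open import Data.Fin using (Fin; toℕ; punchIn)
open import Data.Fin.Properties using (toℕ<n; toℕ-inject₁; toℕ-fromℕ)
open import Data.Product using (_×_; _,_)
open import Data.Sum using (inj₁; inj₂)
open import Data.Empty using (⊥-elim)
open import Relation.Binary.PropositionalEquality
  using (_≡_; _≢_; refl; cong; cong₂; subst; sym; trans; module ≡-Reasoning)
open import Relation.Binary.Definitions using (tri<; tri≈; tri>)
open import Relation.Nullary using (yes; no)

≡ᵇ-refl : ∀ m → (m ≡ᵇ m) ≡ true
≡ᵇ-refl zero = refl
≡ᵇ-refl (suc m) = ≡ᵇ-refl m

≢⇒≡ᵇ-false : ∀ {m n} → m ≢ n → (m ≡ᵇ n) ≡ false
≢⇒≡ᵇ-false {zero} {zero} m≢n = ⊥-elim (m≢n refl)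
≢⇒≡ᵇ-false {zero} {suc n} _ = refl
≢⇒≡ᵇ-false {suc m} {zero} _ = refl
≢⇒≡ᵇ-false {suc m} {suc n} m≢n = ≢⇒≡ᵇ-false (λ e → m≢n (cong suc e))

<⇒<ᵇ-true : ∀ {m n} → m < n → (m <ᵇ n) ≡ true
<⇒<ᵇ-true {zero} {suc n} _ = refl
<⇒<ᵇ-true {suc m} {suc n} (s≤s m<n) = <⇒<ᵇ-true m<n

≥⇒<ᵇ-false : ∀ {m n} → n ≤ m → (m <ᵇ n) ≡ false
≥⇒<ᵇ-false {m} {zero} _ = refl
≥⇒<ᵇ-false {suc m} {suc n} (s≤s n≤m) = ≥⇒<ᵇ-false n≤m

≡ᵇ-true⇒≡ : ∀ {m n} → (m ≡ᵇ n) ≡ true → m ≡ n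
≡ᵇ-true⇒≡ {zero} {zero} _ = refl
≡ᵇ-true⇒≡ {suc m} {suc n} e = cong suc (≡ᵇ-true⇒≡ e)

≡ᵇ-sym : ∀ m n → (m ≡ᵇ n) ≡ (n ≡ᵇ m)
≡ᵇ-sym zero zero = refl
≡ᵇ-sym zero (suc n) = refl
≡ᵇ-sym (suc m) zero = refl
≡ᵇ-sym (suc m) (suc n) = ≡ᵇ-sym m n

≡ᵇ-+ : ∀ m i j → (m +ℕ i ≡ᵇ m +ℕ j) ≡ (i ≡ᵇ j)
≡ᵇ-+ zero i j = refl
≡ᵇ-+ (suc m) i j = ≡ᵇ-+ m i j

≡ᵇ-+ˡ : ∀ m j → (m ≡ᵇ m +ℕ j) ≡ (0 ≡ᵇ j)
≡ᵇ-+ˡ zero j = refl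
≡ᵇ-+ˡ (suc m) j = ≡ᵇ-+ˡ m j

punchInℕ : ℕ → ℕ → ℕ
punchInℕ zero b = suc b
punchInℕ (suc j) zero = zero
punchInℕ (suc j) (suc b) = suc (punchInℕ j b)

punchOutℕ : ℕ → ℕ → ℕ
punchOutℕ zero zero = zero
punchOutℕ zero (suc c) = c
punchOutℕ (suc j) zero = zero
punchOutℕ (suc j) (suc c) = suc (punchOutℕ j c)

toℕ-punchIn : ∀ {n} (i : Fin (suc n)) (j : Fin n) → toℕ (punchIn i j) ≡ punchInℕ (toℕ i) (toℕ j)
toℕ-punchIn Fin.zero j = refl
toℕ-punchIn (Fin.suc i) Fin.zero = refl
toℕ-punchIn (Fin.suc i) (Fin.suc j) = cong suc (toℕ-punchIn i j)

punchInℕ-punchOutℕ : ∀ {j c} → j ≢ c → punchInℕ j (punchOutℕ j c) ≡ c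
punchInℕ-punchOutℕ {zero} {zero} j≢c = ⊥-elim (j≢c refl)
punchInℕ-punchOutℕ {zero} {suc c} _ = refl
punchInℕ-punchOutℕ {suc j} {zero} _ = refl
punchInℕ-punchOutℕ {suc j} {suc c} j≢c = cong suc (punchInℕ-punchOutℕ (λ e → j≢c (cong suc e)))

punchOutℕ-punchInℕ : ∀ j b → punchOutℕ j (punchInℕ j b) ≡ b
punchOutℕ-punchInℕ zero b = refl
punchOutℕ-punchInℕ (suc j) zero = refl
punchOutℕ-punchInℕ (suc j) (suc b) = cong suc (punchOutℕ-punchInℕ j b)

punchInℕᵢ≢i : ∀ j b → punchInℕ j b ≢ j
punchInℕᵢ≢i (suc j) zero ()
punchInℕᵢ≢i (suc j) (suc b) e = punchInℕᵢ≢i j b (ℕ.suc-injective e)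

punchInℕ-≢ : ∀ {j c} b → b ≢ punchOutℕ j c → punchInℕ j b ≢ c
punchInℕ-≢ {j} b b≢ e = b≢ (trans (sym (punchOutℕ-punchInℕ j b)) (cong (punchOutℕ j) e))

punchInℕ-< : ∀ {j b} → b < j → punchInℕ j b ≡ b
punchInℕ-< {suc j} {zero} _ = refl
punchInℕ-< {suc j} {suc b} (s≤s b<j) = cong suc (punchInℕ-< b<j)

punchInℕ-≥ : ∀ {j b} → j ≤ b → punchInℕ j b ≡ suc b
punchInℕ-≥ {zero} _ = refl
punchInℕ-≥ {suc j} {suc b} (s≤s j≤b) = cong suc (punchInℕ-≥ j≤b)

punchInℕ-bounded : ∀ {N j b} → b < N → j < suc N → punchInℕ j b < suc N
punchInℕ-bounded {j = zero} b<N _ = s≤s b<N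
punchInℕ-bounded {suc N} {suc j} {zero} _ _ = s≤s z≤n
punchInℕ-bounded {suc N} {suc j} {suc b} (s≤s b<N) (s≤s j≤N) = s≤s (punchInℕ-bounded b<N j≤N)

punchOutℕ-bounded : ∀ {N j c} → j ≢ c → c < suc N → j < suc N → punchOutℕ j c < N
punchOutℕ-bounded {j = zero} {zero} j≢c _ _ = ⊥-elim (j≢c refl)
punchOutℕ-bounded {j = zero} {suc c} _ (s≤s c<N) _ = c<N
punchOutℕ-bounded {zero} {suc j} _ _ (s≤s ())
punchOutℕ-bounded {suc N} {suc j} {zero} _ _ _ = s≤s z≤n
punchOutℕ-bounded {suc N} {suc j} {suc c} j≢c (s≤s c<N) (s≤s j<N) =
  s≤s (punchOutℕ-bounded (λ e → j≢c (cong suc e)) c<N j<N)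

punchOutℕ-suc : ∀ {j c} → j ≢ c → j ≢ suc c → punchOutℕ j (suc c) ≡ suc (punchOutℕ j c)
punchOutℕ-suc {zero} {zero} j≢c _ = ⊥-elim (j≢c refl)
punchOutℕ-suc {zero} {suc c} _ _ = refl
punchOutℕ-suc {suc zero} {zero} _ j≢1 = ⊥-elim (j≢1 refl)
punchOutℕ-suc {suc (suc j)} {zero} _ _ = refl
punchOutℕ-suc {suc j} {suc c} j≢c j≢sc =
  cong suc (punchOutℕ-suc (λ e → j≢c (cong suc e)) (λ e → j≢sc (cong suc e)))

swapℕ : ℕ → ℕ → ℕ
swapℕ zero zero = 1
swapℕ zero (suc zero) = zero
swapℕ zero (suc (suc j)) = suc (suc j)
swapℕ (suc d) zero = zero
swapℕ (suc d) (suc j) = suc (swapℕ d j)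

swapℕ-left : ∀ d → swapℕ d d ≡ suc d
swapℕ-left zero = refl
swapℕ-left (suc d) = cong suc (swapℕ-left d)

swapℕ-right : ∀ d → swapℕ d (suc d) ≡ d
swapℕ-right zero = refl
swapℕ-right (suc d) = cong suc (swapℕ-right d)

swapℕ-other : ∀ {d j} → j ≢ d → j ≢ suc d → swapℕ d j ≡ j
swapℕ-other {zero} {zero} j≢d _ = ⊥-elim (j≢d refl)
swapℕ-other {zero} {suc zero} _ j≢1 = ⊥-elim (j≢1 refl)
swapℕ-other {zero} {suc (suc j)} _ _ = refl
swapℕ-other {suc d} {zero} _ _ = refl
swapℕ-other {suc d} {suc j} j≢d j≢sd = cong suc (swapℕ-other (λ e → j≢d (cong suc e)) (λ e → j≢sd (cong suc e)))

module Determinant {c ℓ : Level} (R : CommutativeRing c ℓ) where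
  open CommutativeRing R hiding (zero) renaming (Carrier to A; refl to ≈-refl; sym to ≈-sym; trans to ≈-trans)
  open import Relation.Binary.Reasoning.Setoid setoid
  open import Algebra.Properties.Ring ring using (-‿distribˡ-*; -‿distribʳ-*; -‿involutive; -‿+-comm; -0#≈0#)
  open import Algebra.Properties.Semiring.Sum semiring using (sum; sum-cong-≋; ∑-distrib-+; *-distribˡ-sum; sum-init-last; sum-replicate-zero)
  open import Algebra.Solver.Ring.NaturalCoefficients.Default commutativeSemiring using (solve; _:+_; _:*_; _:=_)

  δ : ℕ → ℕ → A
  δ i j = if i ≡ᵇ j then 1# else 0#

  δ-refl : ∀ i → δ i i ≡ 1#
  δ-refl i rewrite ≡ᵇ-refl i = refl

  δ-≢ : ∀ {i j} → i ≢ j → δ i j ≡ 0#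
  δ-≢ i≢j rewrite ≢⇒≡ᵇ-false i≢j = refl

  δ-sym : ∀ i j → δ i j ≡ δ j i
  δ-sym i j = cong (λ b → if b then 1# else 0#) (≡ᵇ-sym i j)

  δ-+ : ∀ m i j → δ (m +ℕ i) (m +ℕ j) ≡ δ i j
  δ-+ m i j = cong (λ b → if b then 1# else 0#) (≡ᵇ-+ m i j)

  δ-+ˡ : ∀ m j → δ m (m +ℕ j) ≡ δ j 0
  δ-+ˡ m j = trans (cong (λ b → if b then 1# else 0#) (≡ᵇ-+ˡ m j)) (δ-sym 0 j)

  δ-< : ∀ {i j} → i < j → δ j i ≡ 0#
  δ-< i<j = δ-≢ (λ e → ℕ.<⇒≢ i<j (sym e))

  δ-> : ∀ {i j} → i < j → δ i j ≡ 0#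
  δ-> i<j = δ-≢ (ℕ.<⇒≢ i<j)

  sumFin≡sum : ∀ n (f : Fin n → A) → sumFin R n f ≡ sum f
  sumFin≡sum zero f = refl
  sumFin≡sum (suc n) f = cong (f Fin.zero +_) (sumFin≡sum n (λ j → f (Fin.suc j)))

  sumℕ : ℕ → (ℕ → A) → A
  sumℕ N g = sum {N} (λ j → g (toℕ j))

  detℕ : ℕ → (ℕ → ℕ → A) → A
  detℕ N f = det R N (λ i j → f (toℕ i) (toℕ j))

  minorℕ : ℕ → (ℕ → ℕ → A) → ℕ → ℕ → A
  minorℕ j f a b = f (suc a) (punchInℕ j b)

  expansionTerm : ℕ → (ℕ → ℕ → A) → ℕ → A
  expansionTerm N f j = sgn R j * (f 0 j * detℕ N (minorℕ j f))

  sumℕ-cong : ∀ N {g h : ℕ → A} → (∀ j → j < N → g j ≈ h j) → sumℕ N g ≈ sumℕ N h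
  sumℕ-cong N g≈h = sum-cong-≋ {N} (λ j → g≈h (toℕ j) (toℕ<n j))

  sumFin-cong : ∀ N {F G : Fin N → A} → (∀ j → F j ≈ G j) → sumFin R N F ≈ sumFin R N G
  sumFin-cong zero _ = ≈-refl
  sumFin-cong (suc N) F≈G = +-cong (F≈G Fin.zero) (sumFin-cong N (λ j → F≈G (Fin.suc j)))

  det-cong : ∀ N {M M′ : Fin N → Fin N → A} → (∀ i j → M i j ≈ M′ i j) → det R N M ≈ det R N M′
  det-cong zero _ = ≈-refl
  det-cong (suc N) {M} {M′} M≈M′ = sumFin-cong (suc N) {term M} {term M′} λ j →
    *-congˡ (*-cong (M≈M′ Fin.zero j) (det-cong N (λ a b → M≈M′ (Fin.suc a) (punchIn j b))))
    where
    term : (Fin (suc N) → Fin (suc N) → A) → Fin (suc N) → A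
    term K j = sgn R (toℕ j) * (K Fin.zero j * det R N (λ a b → K (Fin.suc a) (punchIn j b)))

  detℕ-cong : ∀ N {f g : ℕ → ℕ → A} → (∀ i j → i < N → j < N → f i j ≈ g i j) → detℕ N f ≈ detℕ N g
  detℕ-cong N f≈g = det-cong N (λ i j → f≈g (toℕ i) (toℕ j) (toℕ<n i) (toℕ<n j))

  detℕ-expand : ∀ N f → detℕ (suc N) f ≈ sumℕ (suc N) (expansionTerm N f)
  detℕ-expand N f = ≈-trans
    (sumFin-cong (suc N) {λ j → sgn R (toℕ j) * (f 0 (toℕ j) * det R N (λ a b → f (suc (toℕ a)) (toℕ (punchIn j b))))}
                         {λ j → expansionTerm N f (toℕ j)}
      λ j → *-congˡ (*-congˡ (det-cong N (λ a b → reflexive (cong (f (suc (toℕ a))) (toℕ-punchIn j b))))))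
    (reflexive (sumFin≡sum (suc N) (λ j → expansionTerm N f (toℕ j))))

  sumℕ-distrib-+ : ∀ N (g h : ℕ → A) → sumℕ N (λ j → g j + h j) ≈ sumℕ N g + sumℕ N h
  sumℕ-distrib-+ N g h = ∑-distrib-+ {N} (λ j → g (toℕ j)) (λ j → h (toℕ j))

  sumℕ-distribˡ-* : ∀ N x (g : ℕ → A) → sumℕ N (λ j → x * g j) ≈ x * sumℕ N g
  sumℕ-distribˡ-* N x g = ≈-sym (*-distribˡ-sum {N} x (λ j → g (toℕ j)))

  sumℕ-zero : ∀ N (g : ℕ → A) → (∀ j → j < N → g j ≈ 0#) → sumℕ N g ≈ 0#
  sumℕ-zero N g g≈0 = ≈-trans (sumℕ-cong N g≈0) (sum-replicate-zero N)

  sumℕ-neg : ∀ N (g : ℕ → A) → sumℕ N (λ j → - g j) ≈ - sumℕ N g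
  sumℕ-neg zero g = ≈-sym -0#≈0#
  sumℕ-neg (suc N) g = ≈-trans (+-congˡ (sumℕ-neg N (λ j → g (suc j)))) (-‿+-comm (g 0) _)

  sumℕ-snoc : ∀ N (g : ℕ → A) → sumℕ (suc N) g ≈ sumℕ N g + g N
  sumℕ-snoc N g = ≈-trans (sum-init-last {N} (λ j → g (toℕ j)))
    (+-cong (sum-cong-≋ {N} (λ j → reflexive (cong g (toℕ-inject₁ j)))) (reflexive (cong g (toℕ-fromℕ N))))

  sumℕ-cong-adjacent : ∀ N c (g h : ℕ → A) → suc c < N →
    (∀ j → j < N → j ≢ c → j ≢ suc c → g j ≈ h j) → g c + g (suc c) ≈ h c + h (suc c) →
    sumℕ N g ≈ sumℕ N h
  sumℕ-cong-adjacent (suc (suc N)) zero g h _ g≈h pair = begin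
    g 0 + (g 1 + sumℕ N (λ j → g (suc (suc j))))
      ≈⟨ ≈-sym (+-assoc (g 0) (g 1) _) ⟩
    (g 0 + g 1) + sumℕ N (λ j → g (suc (suc j)))
      ≈⟨ +-cong pair (sumℕ-cong N (λ j j<N → g≈h (suc (suc j)) (s≤s (s≤s j<N)) (λ ()) (λ ()))) ⟩
    (h 0 + h 1) + sumℕ N (λ j → h (suc (suc j)))
      ≈⟨ +-assoc (h 0) (h 1) _ ⟩
    h 0 + (h 1 + sumℕ N (λ j → h (suc (suc j)))) ∎
  sumℕ-cong-adjacent (suc N) (suc c) g h (s≤s c<N) g≈h pair =
    +-cong (g≈h 0 (s≤s z≤n) (λ ()) (λ ()))
      (sumℕ-cong-adjacent N c (λ j → g (suc j)) (λ j → h (suc j)) c<N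
        (λ j j<N j≢c j≢sc → g≈h (suc j) (s≤s j<N) (λ e → j≢c (ℕ.suc-injective e)) (λ e → j≢sc (ℕ.suc-injective e)))
        pair)

  linear-in-second : ∀ s l m g h d → s * ((l * g + m * h) * d) ≈ l * (s * (g * d)) + m * (s * (h * d))
  linear-in-second = solve 6 (λ s l m g h d → s :* ((l :* g :+ m :* h) :* d) := l :* (s :* (g :* d)) :+ m :* (s :* (h :* d))) ≈-refl

  linear-in-third : ∀ s l m f g h → s * (f * (l * g + m * h)) ≈ l * (s * (f * g)) + m * (s * (f * h))
  linear-in-third = solve 6 (λ s l m f g h → s :* (f :* (l :* g :+ m :* h)) := l :* (s :* (f :* g)) :+ m :* (s :* (f :* h))) ≈-refl

  detℕ-linear-expansion : ∀ N (l m : A) f g h →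
    (∀ j → j < suc N → expansionTerm N f j ≈ l * expansionTerm N g j + m * expansionTerm N h j) →
    detℕ (suc N) f ≈ l * detℕ (suc N) g + m * detℕ (suc N) h
  detℕ-linear-expansion N l m f g h linear = begin
    detℕ (suc N) f                                               ≈⟨ detℕ-expand N f ⟩
    sumℕ (suc N) (expansionTerm N f)                             ≈⟨ sumℕ-cong (suc N) linear ⟩
    sumℕ (suc N) (λ j → l * expansionTerm N g j + m * expansionTerm N h j)
      ≈⟨ sumℕ-distrib-+ (suc N) (λ j → l * expansionTerm N g j) (λ j → m * expansionTerm N h j) ⟩
    sumℕ (suc N) (λ j → l * expansionTerm N g j) + sumℕ (suc N) (λ j → m * expansionTerm N h j)
      ≈⟨ +-cong (sumℕ-distribˡ-* (suc N) l (expansionTerm N g)) (sumℕ-distribˡ-* (suc N) m (expansionTerm N h)) ⟩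
    l * sumℕ (suc N) (expansionTerm N g) + m * sumℕ (suc N) (expansionTerm N h)
      ≈⟨ +-cong (*-congˡ (≈-sym (detℕ-expand N g))) (*-congˡ (≈-sym (detℕ-expand N h))) ⟩
    l * detℕ (suc N) g + m * detℕ (suc N) h ∎

  detℕ-linear-column : ∀ N c → c < N → ∀ (l m : A) (f g h : ℕ → ℕ → A) →
    (∀ i j → j ≢ c → f i j ≈ g i j) → (∀ i j → j ≢ c → f i j ≈ h i j) →
    (∀ i → f i c ≈ l * g i c + m * h i c) → detℕ N f ≈ l * detℕ N g + m * detℕ N h
  detℕ-linear-column (suc N) c c<N l m f g h f≈g f≈h column = detℕ-linear-expansion N l m f g h term
    where
    term : ∀ j → j < suc N → expansionTerm N f j ≈ l * expansionTerm N g j + m * expansionTerm N h j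
    term j j<N with j ≟ c
    ... | yes refl = begin
      sgn R c * (f 0 c * D)                       ≈⟨ *-congˡ (*-cong (column 0) ≈-refl) ⟩
      sgn R c * ((l * g 0 c + m * h 0 c) * D)
        ≈⟨ linear-in-second (sgn R c) l m (g 0 c) (h 0 c) D ⟩
      l * (sgn R c * (g 0 c * D)) + m * (sgn R c * (h 0 c * D))
        ≈⟨ +-cong (*-congˡ (*-congˡ (*-congˡ (minor≈ f≈g))))
                  (*-congˡ (*-congˡ (*-congˡ (minor≈ f≈h)))) ⟩
      l * expansionTerm N g c + m * expansionTerm N h c ∎
      where
      D : A
      D = detℕ N (minorℕ c f)
      minor≈ : ∀ {k} → (∀ i j → j ≢ c → f i j ≈ k i j) → D ≈ detℕ N (minorℕ c k)
      minor≈ f≈k = detℕ-cong N (λ a b _ _ → f≈k (suc a) (punchInℕ c b) (punchInℕᵢ≢i c b))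
    ... | no j≢c = begin
      sgn R j * (f 0 j * detℕ N (minorℕ j f))
        ≈⟨ *-congˡ (*-congˡ minor-linear) ⟩
      sgn R j * (f 0 j * (l * Dg + m * Dh))
        ≈⟨ linear-in-third (sgn R j) l m (f 0 j) Dg Dh ⟩
      l * (sgn R j * (f 0 j * Dg)) + m * (sgn R j * (f 0 j * Dh))
        ≈⟨ +-cong (*-congˡ (*-congˡ (*-cong (f≈g 0 j j≢c) ≈-refl)))
                  (*-congˡ (*-congˡ (*-cong (f≈h 0 j j≢c) ≈-refl))) ⟩
      l * expansionTerm N g j + m * expansionTerm N h j ∎
      where
      Dg : A
      Dg = detℕ N (minorℕ j g)
      Dh : A
      Dh = detℕ N (minorℕ j h)
      column′ : ∀ a → minorℕ j f a (punchOutℕ j c) ≈ l * minorℕ j g a (punchOutℕ j c) + m * minorℕ j h a (punchOutℕ j c)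
      column′ a rewrite punchInℕ-punchOutℕ j≢c = column (suc a)
      minor-linear : detℕ N (minorℕ j f) ≈ l * Dg + m * Dh
      minor-linear = detℕ-linear-column N (punchOutℕ j c) (punchOutℕ-bounded j≢c c<N j<N) l m
        (minorℕ j f) (minorℕ j g) (minorℕ j h)
        (λ a b b≢ → f≈g (suc a) (punchInℕ j b) (punchInℕ-≢ b b≢))
        (λ a b b≢ → f≈h (suc a) (punchInℕ j b) (punchInℕ-≢ b b≢))
        column′

  detℕ-linear-row : ∀ N r → r < N → ∀ (l m : A) (f g h : ℕ → ℕ → A) →
    (∀ i j → i ≢ r → f i j ≈ g i j) → (∀ i j → i ≢ r → f i j ≈ h i j) →
    (∀ j → f r j ≈ l * g r j + m * h r j) → detℕ N f ≈ l * detℕ N g + m * detℕ N h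
  detℕ-linear-row (suc N) zero _ l m f g h f≈g f≈h row = detℕ-linear-expansion N l m f g h term
    where
    minor≈ : ∀ {j k} → (∀ i j → i ≢ 0 → f i j ≈ k i j) → detℕ N (minorℕ j f) ≈ detℕ N (minorℕ j k)
    minor≈ {j} f≈k = detℕ-cong N (λ a b _ _ → f≈k (suc a) (punchInℕ j b) (λ ()))
    term : ∀ j → j < suc N → expansionTerm N f j ≈ l * expansionTerm N g j + m * expansionTerm N h j
    term j _ = begin
      sgn R j * (f 0 j * D)                     ≈⟨ *-congˡ (*-cong (row j) ≈-refl) ⟩
      sgn R j * ((l * g 0 j + m * h 0 j) * D)   ≈⟨ linear-in-second (sgn R j) l m (g 0 j) (h 0 j) D ⟩
      l * (sgn R j * (g 0 j * D)) + m * (sgn R j * (h 0 j * D))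
        ≈⟨ +-cong (*-congˡ (*-congˡ (*-congˡ (minor≈ f≈g)))) (*-congˡ (*-congˡ (*-congˡ (minor≈ f≈h)))) ⟩
      l * expansionTerm N g j + m * expansionTerm N h j ∎
      where
      D : A
      D = detℕ N (minorℕ j f)
  detℕ-linear-row (suc N) (suc r) (s≤s r<N) l m f g h f≈g f≈h row = detℕ-linear-expansion N l m f g h λ j _ → begin
    sgn R j * (f 0 j * detℕ N (minorℕ j f))
      ≈⟨ *-congˡ (*-congˡ (detℕ-linear-row N r r<N l m (minorℕ j f) (minorℕ j g) (minorℕ j h)
           (λ a b a≢r → f≈g (suc a) (punchInℕ j b) (λ e → a≢r (ℕ.suc-injective e)))
           (λ a b a≢r → f≈h (suc a) (punchInℕ j b) (λ e → a≢r (ℕ.suc-injective e)))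
           (λ b → row (punchInℕ j b)))) ⟩
    sgn R j * (f 0 j * (l * detℕ N (minorℕ j g) + m * detℕ N (minorℕ j h)))
      ≈⟨ linear-in-third (sgn R j) l m (f 0 j) _ _ ⟩
    l * (sgn R j * (f 0 j * detℕ N (minorℕ j g))) + m * (sgn R j * (f 0 j * detℕ N (minorℕ j h)))
      ≈⟨ +-cong (*-congˡ (*-congˡ (*-cong (f≈g 0 j (λ ())) ≈-refl))) (*-congˡ (*-congˡ (*-cong (f≈h 0 j (λ ())) ≈-refl))) ⟩
    l * expansionTerm N g j + m * expansionTerm N h j ∎

  minor-swap : ∀ c (u v : ℕ → A) → u c ≈ v (suc c) → u (suc c) ≈ v c →
    (∀ j → j ≢ c → j ≢ suc c → u j ≈ v j) → ∀ b → u (punchInℕ c b) ≈ v (punchInℕ (suc c) b)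
  minor-swap zero u v _ u1≈v0 _ zero = u1≈v0
  minor-swap zero u v _ _ u≈v (suc b) = u≈v (suc (suc b)) (λ ()) (λ ())
  minor-swap (suc c) u v _ _ u≈v zero = u≈v zero (λ ()) (λ ())
  minor-swap (suc c) u v uc≈v uc′≈v u≈v (suc b) =
    minor-swap c (λ j → u (suc j)) (λ j → v (suc j)) uc≈v uc′≈v
      (λ j j≢c j≢sc → u≈v (suc j) (λ e → j≢c (ℕ.suc-injective e)) (λ e → j≢sc (ℕ.suc-injective e))) b

  detℕ-swap-adjacent-columns : ∀ N c → suc c < N → (f g : ℕ → ℕ → A) →
    (∀ i → g i c ≈ f i (suc c)) → (∀ i → g i (suc c) ≈ f i c) →
    (∀ i j → j ≢ c → j ≢ suc c → g i j ≈ f i j) → detℕ N g ≈ - detℕ N f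
  detℕ-swap-adjacent-columns (suc N) c sc<N f g gc≈ gsc≈ g≈f = begin
    detℕ (suc N) g                                    ≈⟨ detℕ-expand N g ⟩
    sumℕ (suc N) (expansionTerm N g)
      ≈⟨ sumℕ-cong-adjacent (suc N) c (expansionTerm N g) (λ j → - expansionTerm N f j) sc<N other pair ⟩
    sumℕ (suc N) (λ j → - expansionTerm N f j)        ≈⟨ sumℕ-neg (suc N) (expansionTerm N f) ⟩
    - sumℕ (suc N) (expansionTerm N f)                ≈⟨ -‿cong (≈-sym (detℕ-expand N f)) ⟩
    - detℕ (suc N) f                                  ∎
    where
    other : ∀ j → j < suc N → j ≢ c → j ≢ suc c → expansionTerm N g j ≈ - expansionTerm N f j
    other j j<N j≢c j≢sc = begin
      sgn R j * (g 0 j * detℕ N (minorℕ j g))   ≈⟨ *-congˡ (*-cong (g≈f 0 j j≢c j≢sc) swapped) ⟩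
      sgn R j * (f 0 j * - detℕ N (minorℕ j f))   ≈⟨ *-congˡ (≈-sym (-‿distribʳ-* _ _)) ⟩
      sgn R j * - (f 0 j * detℕ N (minorℕ j f))   ≈⟨ ≈-sym (-‿distribʳ-* _ _) ⟩
      - expansionTerm N f j                       ∎
      where
      c′ : ℕ
      c′ = punchOutℕ j c
      sc′≡ : punchOutℕ j (suc c) ≡ suc c′
      sc′≡ = punchOutℕ-suc j≢c j≢sc
      column₁ : ∀ a → minorℕ j g a c′ ≈ minorℕ j f a (suc c′)
      column₁ a rewrite punchInℕ-punchOutℕ j≢c | sym sc′≡ | punchInℕ-punchOutℕ j≢sc = gc≈ (suc a)
      column₂ : ∀ a → minorℕ j g a (suc c′) ≈ minorℕ j f a c′
      column₂ a rewrite punchInℕ-punchOutℕ j≢c | sym sc′≡ | punchInℕ-punchOutℕ j≢sc = gsc≈ (suc a)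
      swapped : detℕ N (minorℕ j g) ≈ - detℕ N (minorℕ j f)
      swapped = detℕ-swap-adjacent-columns N c′
        (subst (_< N) sc′≡ (punchOutℕ-bounded j≢sc sc<N j<N)) (minorℕ j f) (minorℕ j g)
        column₁ column₂
        (λ a b b≢c′ b≢sc′ → g≈f (suc a) (punchInℕ j b) (punchInℕ-≢ b b≢c′)
           (punchInℕ-≢ b (λ e → b≢sc′ (trans e sc′≡))))
    pair : expansionTerm N g c + expansionTerm N g (suc c) ≈ - expansionTerm N f c + - expansionTerm N f (suc c)
    pair = begin
      sgn R c * (g 0 c * detℕ N (minorℕ c g)) + - sgn R c * (g 0 (suc c) * detℕ N (minorℕ (suc c) g))
        ≈⟨ +-cong (*-congˡ (*-cong (gc≈ 0) minors₁)) (*-congˡ (*-cong (gsc≈ 0) minors₂)) ⟩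
      sgn R c * Tsc + - sgn R c * Tc  ≈⟨ +-comm _ _ ⟩
      - sgn R c * Tc + sgn R c * Tsc  ≈⟨ +-cong (≈-sym (-‿distribˡ-* _ _)) (≈-sym (≈-trans (-‿cong (≈-sym (-‿distribˡ-* _ _))) (-‿involutive _))) ⟩
      - expansionTerm N f c + - expansionTerm N f (suc c) ∎
      where
      Tc : A
      Tc = f 0 c * detℕ N (minorℕ c f)
      Tsc : A
      Tsc = f 0 (suc c) * detℕ N (minorℕ (suc c) f)
      minors₁ : detℕ N (minorℕ c g) ≈ detℕ N (minorℕ (suc c) f)
      minors₁ = detℕ-cong N λ a b _ _ → minor-swap c (g (suc a)) (f (suc a)) (gc≈ (suc a)) (gsc≈ (suc a)) (g≈f (suc a)) b
      minors₂ : detℕ N (minorℕ (suc c) g) ≈ detℕ N (minorℕ c f)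
      minors₂ = detℕ-cong N λ a b _ _ → ≈-sym (minor-swap c (f (suc a)) (g (suc a))
        (≈-sym (gsc≈ (suc a))) (≈-sym (gc≈ (suc a))) (λ j j≢c j≢sc → ≈-sym (g≈f (suc a) j j≢c j≢sc)) b)

  detℕ-equal-adjacent-columns : ∀ N c → suc c < N → (f : ℕ → ℕ → A) →
    (∀ i → f i c ≈ f i (suc c)) → detℕ N f ≈ 0#
  detℕ-equal-adjacent-columns (suc N) c sc<N f fc≈fsc = begin
    detℕ (suc N) f                     ≈⟨ detℕ-expand N f ⟩
    sumℕ (suc N) (expansionTerm N f)   ≈⟨ sumℕ-cong-adjacent (suc N) c (expansionTerm N f) (λ _ → 0#) sc<N other pair ⟩
    sumℕ (suc N) (λ _ → 0#)            ≈⟨ sumℕ-zero (suc N) (λ _ → 0#) (λ _ _ → ≈-refl) ⟩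
    0#                                 ∎
    where
    other : ∀ j → j < suc N → j ≢ c → j ≢ suc c → expansionTerm N f j ≈ 0#
    other j j<N j≢c j≢sc =
      ≈-trans (*-congˡ (≈-trans (*-congˡ vanishes) (zeroʳ _))) (zeroʳ _)
      where
      c′ : ℕ
      c′ = punchOutℕ j c
      sc′≡ : punchOutℕ j (suc c) ≡ suc c′
      sc′≡ = punchOutℕ-suc j≢c j≢sc
      equal : ∀ a → minorℕ j f a c′ ≈ minorℕ j f a (suc c′)
      equal a rewrite punchInℕ-punchOutℕ j≢c | sym sc′≡ | punchInℕ-punchOutℕ j≢sc = fc≈fsc (suc a)
      vanishes : detℕ N (minorℕ j f) ≈ 0#
      vanishes = detℕ-equal-adjacent-columns N c′ (subst (_< N) sc′≡ (punchOutℕ-bounded j≢sc sc<N j<N)) (minorℕ j f) equal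
    pair : expansionTerm N f c + expansionTerm N f (suc c) ≈ 0# + 0#
    pair = begin
      sgn R c * (f 0 c * detℕ N (minorℕ c f)) + - sgn R c * T
        ≈⟨ +-congʳ (*-congˡ (*-cong (fc≈fsc 0) minors)) ⟩
      sgn R c * T + - sgn R c * T    ≈⟨ +-congˡ (≈-sym (-‿distribˡ-* _ _)) ⟩
      sgn R c * T + - (sgn R c * T)  ≈⟨ -‿inverseʳ _ ⟩
      0#                             ≈⟨ ≈-sym (+-identityʳ 0#) ⟩
      0# + 0#                        ∎
      where
      T : A
      T = f 0 (suc c) * detℕ N (minorℕ (suc c) f)
      minors : detℕ N (minorℕ c f) ≈ detℕ N (minorℕ (suc c) f)
      minors = detℕ-cong N λ a b _ _ → minor-swap c (f (suc a)) (f (suc a)) (fc≈fsc (suc a)) (≈-sym (fc≈fsc (suc a))) (λ _ _ _ → ≈-refl) b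

  detℕ-equal-columns : ∀ N c d → c < d → d < N → (f : ℕ → ℕ → A) → (∀ i → f i c ≈ f i d) → detℕ N f ≈ 0#
  detℕ-equal-columns N c (suc d) c<sd sd<N f fc≈fd with c ≟ d
  ... | yes refl = detℕ-equal-adjacent-columns N c sd<N f fc≈fd
  ... | no c≢d = begin
    detℕ N f          ≈⟨ ≈-sym (-‿involutive _) ⟩
    - (- detℕ N f)    ≈⟨ -‿cong (≈-sym swapped) ⟩
    - detℕ N g        ≈⟨ -‿cong (detℕ-equal-columns N c d c<d (ℕ.<-trans (ℕ.n<1+n d) sd<N) g gc≈gd) ⟩
    - 0#              ≈⟨ -0#≈0# ⟩
    0#                ∎
    where
    c<d : c < d
    c<d = ℕ.≤∧≢⇒< (ℕ.≤-pred c<sd) c≢d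
    g : ℕ → ℕ → A
    g i j = f i (swapℕ d j)
    swapped : detℕ N g ≈ - detℕ N f
    swapped = detℕ-swap-adjacent-columns N d sd<N f g
      (λ i → reflexive (cong (f i) (swapℕ-left d))) (λ i → reflexive (cong (f i) (swapℕ-right d)))
      (λ i j j≢d j≢sd → reflexive (cong (f i) (swapℕ-other j≢d j≢sd)))
    gc≈gd : ∀ i → g i c ≈ g i d
    gc≈gd i = ≈-trans (reflexive (cong (f i) (swapℕ-other c≢d (ℕ.<⇒≢ c<sd))))
                      (≈-trans (fc≈fd i) (reflexive (cong (f i) (sym (swapℕ-left d)))))

  addColumn : ℕ → ℕ → A → (ℕ → ℕ → A) → ℕ → ℕ → A
  addColumn c d l f i j = f i j + δ c j * (l * f i d)

  detℕ-addColumn : ∀ N c d l f → c ≢ d → c < N → d < N → detℕ N (addColumn c d l f) ≈ detℕ N f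
  detℕ-addColumn N c d l f c≢d c<N d<N = begin
    detℕ N (addColumn c d l f)        ≈⟨ detℕ-linear-column N c c<N 1# l (addColumn c d l f) f g unchanged unchanged′ column ⟩
    1# * detℕ N f + l * detℕ N g      ≈⟨ +-cong (*-identityˡ _) (≈-trans (*-congˡ repeated) (zeroʳ l)) ⟩
    detℕ N f + 0#                     ≈⟨ +-identityʳ _ ⟩
    detℕ N f                          ∎
    where
    g : ℕ → ℕ → A
    g i j = if j ≡ᵇ c then f i d else f i j
    unchanged : ∀ i j → j ≢ c → addColumn c d l f i j ≈ f i j
    unchanged i j j≢c rewrite δ-≢ (λ e → j≢c (sym e)) = ≈-trans (+-congˡ (zeroˡ _)) (+-identityʳ _)
    unchanged′ : ∀ i j → j ≢ c → addColumn c d l f i j ≈ g i j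
    unchanged′ i j j≢c rewrite ≢⇒≡ᵇ-false j≢c = unchanged i j j≢c
    column : ∀ i → addColumn c d l f i c ≈ 1# * f i c + l * g i c
    column i rewrite δ-refl c | ≡ᵇ-refl c = +-cong (≈-sym (*-identityˡ _)) (*-identityˡ _)
    gc≈gd : ∀ i → g i c ≈ g i d
    gc≈gd i rewrite ≡ᵇ-refl c | ≢⇒≡ᵇ-false (λ e → c≢d (sym e)) = ≈-refl
    repeated : detℕ N g ≈ 0#
    repeated with ℕ.<-cmp c d
    ... | tri< c<d _ _ = detℕ-equal-columns N c d c<d d<N g gc≈gd
    ... | tri≈ _ c≡d _ = ⊥-elim (c≢d c≡d)
    ... | tri> _ _ d<c = detℕ-equal-columns N d c d<c c<N g (λ i → ≈-sym (gc≈gd i))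

  detℕ-lastRow : ∀ N (f : ℕ → ℕ → A) → (∀ j → j < N → f N j ≈ 0#) → detℕ (suc N) f ≈ f N N * detℕ N f
  detℕ-lastRow zero f _ = ≈-trans (+-identityʳ _) (*-identityˡ _)
  detℕ-lastRow (suc M) f row≈0 = begin
    detℕ (suc (suc M)) f                                ≈⟨ detℕ-expand (suc M) f ⟩
    sumℕ (suc (suc M)) (expansionTerm (suc M) f)        ≈⟨ sumℕ-snoc (suc M) (expansionTerm (suc M) f) ⟩
    sumℕ (suc M) (expansionTerm (suc M) f) + expansionTerm (suc M) f (suc M)
      ≈⟨ +-cong (sumℕ-cong (suc M) term) lastTerm ⟩
    sumℕ (suc M) (λ j → corner * expansionTerm M f j) + 0#  ≈⟨ +-identityʳ _ ⟩
    sumℕ (suc M) (λ j → corner * expansionTerm M f j)       ≈⟨ sumℕ-distribˡ-* (suc M) corner (expansionTerm M f) ⟩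
    corner * sumℕ (suc M) (expansionTerm M f)               ≈⟨ *-congˡ (≈-sym (detℕ-expand M f)) ⟩
    corner * detℕ (suc M) f                                 ∎
    where
    corner : A
    corner = f (suc M) (suc M)
    lastTerm : expansionTerm (suc M) f (suc M) ≈ 0#
    lastTerm = ≈-trans (*-congˡ (≈-trans (*-congˡ minor≈0) (zeroʳ _))) (zeroʳ _)
      where
      row′≈0 : ∀ b → b < M → minorℕ (suc M) f M b ≈ 0#
      row′≈0 b b<M rewrite punchInℕ-< (ℕ.m<n⇒m<1+n b<M) = row≈0 b (ℕ.m<n⇒m<1+n b<M)
      minor≈0 : detℕ (suc M) (minorℕ (suc M) f) ≈ 0#
      minor≈0 = ≈-trans (detℕ-lastRow M (minorℕ (suc M) f) row′≈0)
        (≈-trans (*-congʳ (≈-trans (reflexive (cong (f (suc M)) (punchInℕ-< (ℕ.n<1+n M)))) (row≈0 M (ℕ.n<1+n M)))) (zeroˡ _))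
    term : ∀ j → j < suc M → expansionTerm (suc M) f j ≈ corner * expansionTerm M f j
    term j (s≤s j≤M) = begin
      sgn R j * (f 0 j * detℕ (suc M) (minorℕ j f))
        ≈⟨ *-congˡ (*-congˡ (detℕ-lastRow M (minorℕ j f) (λ b b<M → row≈0 (punchInℕ j b) (punchInℕ-bounded b<M (s≤s j≤M))))) ⟩
      sgn R j * (f 0 j * (minorℕ j f M M * detℕ M (minorℕ j f)))
        ≈⟨ *-congˡ (*-congˡ (*-congʳ (reflexive (cong (f (suc M)) (punchInℕ-≥ j≤M))))) ⟩
      sgn R j * (f 0 j * (corner * detℕ M (minorℕ j f)))
        ≈⟨ solve 4 (λ s a b d → s :* (a :* (b :* d)) := b :* (s :* (a :* d))) ≈-refl (sgn R j) (f 0 j) corner _ ⟩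
      corner * expansionTerm M f j ∎

  sgn-square : ∀ d → sgn R d * sgn R d ≈ 1#
  sgn-square zero = *-identityˡ 1#
  sgn-square (suc d) = begin
    - sgn R d * - sgn R d      ≈⟨ ≈-sym (-‿distribˡ-* _ _) ⟩
    - (sgn R d * - sgn R d)    ≈⟨ -‿cong (≈-sym (-‿distribʳ-* _ _)) ⟩
    - - (sgn R d * sgn R d)    ≈⟨ -‿involutive _ ⟩
    sgn R d * sgn R d          ≈⟨ sgn-square d ⟩
    1#                         ∎

  negate-sign : ∀ d x → sgn R d * - x ≈ sgn R (suc d) * x
  negate-sign d x = ≈-trans (≈-sym (-‿distribʳ-* _ _)) (-‿distribˡ-* _ _)

  detℕ-moveColumnLast : ∀ d k N → k +ℕ d ≡ N → (f g : ℕ → ℕ → A) →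
    (∀ i j → j < k → g i j ≈ f i j) → (∀ i j → k ≤ j → j < N → g i j ≈ f i (suc j)) →
    (∀ i → g i N ≈ f i k) → detℕ (suc N) g ≈ sgn R d * detℕ (suc N) f
  detℕ-moveColumnLast zero k N k≡N f g before after last =
    ≈-trans (detℕ-cong (suc N) same) (≈-sym (*-identityˡ _))
    where
    same : ∀ i j → i < suc N → j < suc N → g i j ≈ f i j
    same i j _ (s≤s j≤N) with ℕ.<-cmp j k
    ... | tri< j<k _ _ = before i j j<k
    ... | tri≈ _ refl _ = ≈-trans (reflexive (cong (g i) (trans (sym (ℕ.+-identityʳ j)) k≡N))) (last i)
    ... | tri> _ _ k<j = ⊥-elim (ℕ.<-irrefl refl (ℕ.<-≤-trans k<j (subst (j ≤_) (trans (sym k≡N) (ℕ.+-identityʳ k)) j≤N)))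
  detℕ-moveColumnLast (suc d) k N k+sd≡N f g before after last = begin
    detℕ (suc N) g                ≈⟨ detℕ-moveColumnLast d (suc k) N (trans (sym (ℕ.+-suc k d)) k+sd≡N) f′ g before′ after′ last′ ⟩
    sgn R d * detℕ (suc N) f′     ≈⟨ *-congˡ swapped ⟩
    sgn R d * - detℕ (suc N) f    ≈⟨ negate-sign d _ ⟩
    sgn R (suc d) * detℕ (suc N) f ∎
    where
    k<N : k < N
    k<N = subst (k <_) k+sd≡N (subst (k <_) (sym (ℕ.+-suc k d)) (s≤s (ℕ.m≤m+n k d)))
    f′ : ℕ → ℕ → A
    f′ i j = f i (swapℕ k j)
    swapped : detℕ (suc N) f′ ≈ - detℕ (suc N) f
    swapped = detℕ-swap-adjacent-columns (suc N) k (s≤s k<N) f f′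
      (λ i → reflexive (cong (f i) (swapℕ-left k))) (λ i → reflexive (cong (f i) (swapℕ-right k)))
      (λ i j j≢k j≢sk → reflexive (cong (f i) (swapℕ-other j≢k j≢sk)))
    before′ : ∀ i j → j < suc k → g i j ≈ f′ i j
    before′ i j (s≤s j≤k) with ℕ.m≤n⇒m<n∨m≡n j≤k
    ... | inj₁ j<k = ≈-trans (before i j j<k) (reflexive (cong (f i) (sym (swapℕ-other (ℕ.<⇒≢ j<k) (ℕ.<⇒≢ (ℕ.m<n⇒m<1+n j<k))))))
    ... | inj₂ refl = ≈-trans (after i j ℕ.≤-refl k<N) (reflexive (cong (f i) (sym (swapℕ-left j))))
    after′ : ∀ i j → suc k ≤ j → j < N → g i j ≈ f′ i (suc j)
    after′ i j k<j j<N = ≈-trans (after i j (ℕ.<⇒≤ k<j) j<N)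
      (reflexive (cong (f i) (sym (swapℕ-other (λ e → ℕ.<⇒≢ (ℕ.m<n⇒m<1+n k<j) (sym e)) (λ e → ℕ.<⇒≢ k<j (sym (ℕ.suc-injective e)))))))
    last′ : ∀ i → g i N ≈ f′ i (suc k)
    last′ i = ≈-trans (last i) (reflexive (cong (f i) (sym (swapℕ-right k))))

  detℕ-moveColumnFirst : ∀ m N → m < N → (f g : ℕ → ℕ → A) →
    (∀ i → g i 0 ≈ f i m) → (∀ i j → j < m → g i (suc j) ≈ f i j) →
    (∀ i j → m < j → j < N → g i j ≈ f i j) → detℕ N g ≈ sgn R m * detℕ N f
  detℕ-moveColumnFirst zero N _ f g first _ after = ≈-trans (detℕ-cong N same) (≈-sym (*-identityˡ _))
    where
    same : ∀ i j → i < N → j < N → g i j ≈ f i j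
    same i zero _ _ = first i
    same i (suc j) _ j<N = after i (suc j) (s≤s z≤n) j<N
  detℕ-moveColumnFirst (suc m) N sm<N f g first before after = begin
    detℕ N g                  ≈⟨ detℕ-moveColumnFirst m N (ℕ.<-trans (ℕ.n<1+n m) sm<N) f′ g first′ before′ after′ ⟩
    sgn R m * detℕ N f′       ≈⟨ *-congˡ swapped ⟩
    sgn R m * - detℕ N f      ≈⟨ negate-sign m _ ⟩
    sgn R (suc m) * detℕ N f  ∎
    where
    f′ : ℕ → ℕ → A
    f′ i j = f i (swapℕ m j)
    swapped : detℕ N f′ ≈ - detℕ N f
    swapped = detℕ-swap-adjacent-columns N m sm<N f f′
      (λ i → reflexive (cong (f i) (swapℕ-left m))) (λ i → reflexive (cong (f i) (swapℕ-right m)))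
      (λ i j j≢m j≢sm → reflexive (cong (f i) (swapℕ-other j≢m j≢sm)))
    first′ : ∀ i → g i 0 ≈ f′ i m
    first′ i = ≈-trans (first i) (reflexive (cong (f i) (sym (swapℕ-left m))))
    before′ : ∀ i j → j < m → g i (suc j) ≈ f′ i j
    before′ i j j<m = ≈-trans (before i j (ℕ.m<n⇒m<1+n j<m))
      (reflexive (cong (f i) (sym (swapℕ-other (ℕ.<⇒≢ j<m) (ℕ.<⇒≢ (ℕ.m<n⇒m<1+n j<m))))))
    after′ : ∀ i j → m < j → j < N → g i j ≈ f′ i j
    after′ i j m<j j<N with ℕ.m≤n⇒m<n∨m≡n m<j
    ... | inj₂ refl = ≈-trans (before i m (ℕ.n<1+n m)) (reflexive (cong (f i) (sym (swapℕ-right m))))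
    ... | inj₁ sm<j = ≈-trans (after i j sm<j j<N)
      (reflexive (cong (f i) (sym (swapℕ-other (λ e → ℕ.<⇒≢ m<j (sym e)) (λ e → ℕ.<⇒≢ sm<j (sym e))))))

  lastRowMinor : ℕ → (ℕ → ℕ → A) → ℕ → A
  lastRowMinor P f j = detℕ P (λ a b → f a (punchInℕ j b))

  detℕ-unitLastRow : ∀ P k f → k ≤ P → (∀ j → j < suc P → f P j ≈ δ k j) →
    detℕ (suc P) f ≈ sgn R (P ∸ k) * lastRowMinor P f k
  detℕ-unitLastRow P k f k≤P row = begin
    detℕ (suc P) f                             ≈⟨ ≈-sym (*-identityˡ _) ⟩
    1# * detℕ (suc P) f                        ≈⟨ *-congʳ (≈-sym (sgn-square d)) ⟩
    (sgn R d * sgn R d) * detℕ (suc P) f       ≈⟨ *-assoc _ _ _ ⟩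
    sgn R d * (sgn R d * detℕ (suc P) f)       ≈⟨ *-congˡ (≈-sym moved) ⟩
    sgn R d * detℕ (suc P) g                   ≈⟨ *-congˡ (detℕ-lastRow P g g-lastRow) ⟩
    sgn R d * (g P P * detℕ P g)               ≈⟨ *-congˡ (*-congʳ (≈-trans (last P) (≈-trans (row k (s≤s k≤P)) (reflexive (δ-refl k))))) ⟩
    sgn R d * (1# * detℕ P g)                  ≈⟨ *-congˡ (*-identityˡ _) ⟩
    sgn R d * detℕ P g                         ≈⟨ *-congˡ (detℕ-cong P minor) ⟩
    sgn R d * lastRowMinor P f k               ∎
    where
    d : ℕ
    d = P ∸ k
    g : ℕ → ℕ → A
    g i j = if j <ᵇ k then f i j else if j <ᵇ P then f i (suc j) else f i k
    before : ∀ i j → j < k → g i j ≈ f i j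
    before i j j<k rewrite <⇒<ᵇ-true j<k = ≈-refl
    after : ∀ i j → k ≤ j → j < P → g i j ≈ f i (suc j)
    after i j k≤j j<P rewrite ≥⇒<ᵇ-false k≤j | <⇒<ᵇ-true j<P = ≈-refl
    last : ∀ i → g i P ≈ f i k
    last i rewrite ≥⇒<ᵇ-false k≤P | ≥⇒<ᵇ-false (ℕ.≤-refl {P}) = ≈-refl
    moved : detℕ (suc P) g ≈ sgn R d * detℕ (suc P) f
    moved = detℕ-moveColumnLast d k P (ℕ.m+[n∸m]≡n k≤P) f g before after last
    minor : ∀ a b → a < P → b < P → g a b ≈ f a (punchInℕ k b)
    minor a b _ b<P with ℕ.<-cmp b k
    ... | tri< b<k _ _ = ≈-trans (before a b b<k) (reflexive (cong (f a) (sym (punchInℕ-< b<k))))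
    ... | tri≈ _ b≡k _ = ≈-trans (after a b (ℕ.≤-reflexive (sym b≡k)) b<P) (reflexive (cong (f a) (sym (punchInℕ-≥ (ℕ.≤-reflexive (sym b≡k))))))
    ... | tri> _ _ k<b = ≈-trans (after a b (ℕ.<⇒≤ k<b) b<P) (reflexive (cong (f a) (sym (punchInℕ-≥ (ℕ.<⇒≤ k<b)))))
    g-lastRow : ∀ j → j < P → g P j ≈ 0#
    g-lastRow j j<P with ℕ.<-cmp j k
    ... | tri< j<k _ _ = ≈-trans (before P j j<k) (≈-trans (row j (ℕ.m<n⇒m<1+n j<P)) (reflexive (δ-< j<k)))
    ... | tri≈ _ j≡k _ = ≈-trans (after P j (ℕ.≤-reflexive (sym j≡k)) j<P) (≈-trans (row (suc j) (s≤s j<P)) (reflexive (δ-≢ (λ e → ℕ.<⇒≢ (ℕ.n<1+n j) (trans j≡k e)))))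
    ... | tri> _ _ k<j = ≈-trans (after P j (ℕ.<⇒≤ k<j) j<P) (≈-trans (row (suc j) (s≤s j<P)) (reflexive (δ-≢ (λ e → ℕ.<⇒≢ (ℕ.m<n⇒m<1+n k<j) e))))

  laplaceTerm : ℕ → (ℕ → ℕ → A) → ℕ → A
  laplaceTerm P f j = f P j * (sgn R (P ∸ j) * lastRowMinor P f j)

  detℕ-expand-lastRow : ∀ P f → detℕ (suc P) f ≈ sumℕ (suc P) (laplaceTerm P f)
  detℕ-expand-lastRow P f = ≈-trans (detℕ-cong (suc P) untruncated) (truncated (suc P) ℕ.≤-refl)
    where
    truncate : ℕ → ℕ → ℕ → A
    truncate k i j = if i ≡ᵇ P then (if j <ᵇ k then f P j else 0#) else f i j
    unit : ℕ → ℕ → ℕ → A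
    unit k i j = if i ≡ᵇ P then δ k j else f i j
    truncate-other : ∀ {k} i j → i ≢ P → truncate k i j ≡ f i j
    truncate-other i j i≢P rewrite ≢⇒≡ᵇ-false i≢P = refl
    unit-other : ∀ {k} i j → i ≢ P → unit k i j ≡ f i j
    unit-other i j i≢P rewrite ≢⇒≡ᵇ-false i≢P = refl
    unit-minor : ∀ k → lastRowMinor P (unit k) k ≈ lastRowMinor P f k
    unit-minor k = detℕ-cong P λ a b a<P _ → reflexive (unit-other {k} a (punchInℕ k b) (ℕ.<⇒≢ a<P))
    truncated : ∀ k → k ≤ suc P → detℕ (suc P) (truncate k) ≈ sumℕ k (laplaceTerm P f)
    truncated zero _ = ≈-trans (detℕ-lastRow P (truncate 0) (λ j _ → row≈0 j)) (≈-trans (*-congʳ (row≈0 P)) (zeroˡ _))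
      where
      row≈0 : ∀ j → truncate 0 P j ≈ 0#
      row≈0 j rewrite ≡ᵇ-refl P = ≈-refl
    truncated (suc k) (s≤s k≤P) = begin
      detℕ (suc P) (truncate (suc k))
        ≈⟨ detℕ-linear-row (suc P) P ℕ.≤-refl 1# (f P k) (truncate (suc k)) (truncate k) (unit k)
             (λ i j i≢P → reflexive (trans (truncate-other {suc k} i j i≢P) (sym (truncate-other {k} i j i≢P))))
             (λ i j i≢P → reflexive (trans (truncate-other {suc k} i j i≢P) (sym (unit-other {k} i j i≢P)))) row ⟩
      1# * detℕ (suc P) (truncate k) + f P k * detℕ (suc P) (unit k)
        ≈⟨ +-cong (≈-trans (*-identityˡ _) (truncated k (ℕ.m≤n⇒m≤1+n k≤P)))
                  (*-congˡ (≈-trans (detℕ-unitLastRow P k (unit k) k≤P unit-row) (*-congˡ (unit-minor k)))) ⟩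
      sumℕ k (laplaceTerm P f) + laplaceTerm P f k   ≈⟨ ≈-sym (sumℕ-snoc k (laplaceTerm P f)) ⟩
      sumℕ (suc k) (laplaceTerm P f)                 ∎
      where
      unit-row : ∀ j → j < suc P → unit k P j ≈ δ k j
      unit-row j _ rewrite ≡ᵇ-refl P = ≈-refl
      row : ∀ j → truncate (suc k) P j ≈ 1# * truncate k P j + f P k * unit k P j
      row j rewrite ≡ᵇ-refl P with ℕ.<-cmp j k
      ... | tri< j<k _ _ rewrite <⇒<ᵇ-true (ℕ.m<n⇒m<1+n j<k) | <⇒<ᵇ-true j<k | δ-< j<k =
        ≈-sym (≈-trans (+-cong (*-identityˡ _) (zeroʳ _)) (+-identityʳ _))
      ... | tri≈ _ refl _ rewrite <⇒<ᵇ-true (ℕ.n<1+n j) | ≥⇒<ᵇ-false (ℕ.≤-refl {j}) | δ-refl j =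
        ≈-sym (≈-trans (+-cong (zeroʳ _) (*-identityʳ _)) (+-identityˡ _))
      ... | tri> _ _ k<j rewrite ≥⇒<ᵇ-false k<j | ≥⇒<ᵇ-false (ℕ.<⇒≤ k<j) | δ-> k<j =
        ≈-sym (≈-trans (+-cong (zeroʳ _) (zeroʳ _)) (+-identityʳ _))
    untruncated : ∀ i j → i < suc P → j < suc P → f i j ≈ truncate (suc P) i j
    untruncated i j _ j<sP with i ≟ P
    ... | yes refl rewrite ≡ᵇ-refl i | <⇒<ᵇ-true j<sP = ≈-refl
    ... | no i≢P rewrite ≢⇒≡ᵇ-false i≢P = ≈-refl

  sgn-+ : ∀ a b → sgn R (a +ℕ b) ≈ sgn R a * sgn R b
  sgn-+ zero b = ≈-sym (*-identityˡ _)
  sgn-+ (suc a) b = ≈-trans (-‿cong (sgn-+ a b)) (-‿distribˡ-* _ _)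

  bordered : A → (ℕ → A) → (ℕ → A) → (ℕ → ℕ → A) → ℕ → ℕ → A
  bordered d r c f zero zero = d
  bordered d r c f zero (suc j) = r j
  bordered d r c f (suc i) zero = c i
  bordered d r c f (suc i) (suc j) = f i j

  lastToFront : ℕ → (ℕ → ℕ → A) → ℕ → ℕ → A
  lastToFront P f = bordered (f P P) (f P) (λ i → f i P) f

  laplaceTerm≈expansionTerm : ∀ P f j → j < P → laplaceTerm P f j ≈ expansionTerm P (lastToFront P f) (suc j)
  laplaceTerm≈expansionTerm (suc Q) f j (s≤s j≤Q) = ≈-sym (begin
    - sgn R j * (f (suc Q) j * detℕ (suc Q) (minorℕ (suc j) (lastToFront (suc Q) f)))
      ≈⟨ *-congˡ (*-congˡ moved) ⟩
    - sgn R j * (f (suc Q) j * (sgn R Q * C))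
      ≈⟨ *-congˡ (*-congˡ (*-congʳ (≈-trans (reflexive (cong (sgn R) (sym (ℕ.m+[n∸m]≡n j≤Q)))) (sgn-+ j (Q ∸ j))))) ⟩
    - sgn R j * (f (suc Q) j * ((sgn R j * sgn R (Q ∸ j)) * C))
      ≈⟨ ≈-sym (-‿distribˡ-* _ _) ⟩
    - (sgn R j * (f (suc Q) j * ((sgn R j * sgn R (Q ∸ j)) * C)))
      ≈⟨ -‿cong (solve 4 (λ s t x c → s :* (x :* ((s :* t) :* c)) := (s :* s) :* (x :* (t :* c))) ≈-refl (sgn R j) (sgn R (Q ∸ j)) _ C) ⟩
    - ((sgn R j * sgn R j) * (f (suc Q) j * (sgn R (Q ∸ j) * C)))
      ≈⟨ -‿cong (≈-trans (*-congʳ (sgn-square j)) (*-identityˡ _)) ⟩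
    - (f (suc Q) j * (sgn R (Q ∸ j) * C))
      ≈⟨ -‿distribʳ-* _ _ ⟩
    f (suc Q) j * - (sgn R (Q ∸ j) * C)
      ≈⟨ *-congˡ (-‿distribˡ-* _ _) ⟩
    f (suc Q) j * (sgn R (suc (Q ∸ j)) * C)
      ≈⟨ *-congˡ (*-congʳ (reflexive (cong (sgn R) (sym (ℕ.+-∸-assoc 1 j≤Q))))) ⟩
    laplaceTerm (suc Q) f j ∎)
    where
    K : ℕ → ℕ → A
    K a b = f a (punchInℕ j b)
    C : A
    C = detℕ (suc Q) K
    moved : detℕ (suc Q) (minorℕ (suc j) (lastToFront (suc Q) f)) ≈ sgn R Q * C
    moved = detℕ-moveColumnFirst Q (suc Q) (ℕ.n<1+n Q) K (minorℕ (suc j) (lastToFront (suc Q) f))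
      (λ a → reflexive (cong (f a) (sym (punchInℕ-≥ j≤Q))))
      (λ _ _ _ → ≈-refl)
      (λ _ _ Q<b b<sQ → ⊥-elim (ℕ.<-irrefl refl (ℕ.<-≤-trans Q<b (ℕ.≤-pred b<sQ))))

  detℕ-lastToFront : ∀ P f → detℕ (suc P) f ≈ detℕ (suc P) (lastToFront P f)
  detℕ-lastToFront P f = begin
    detℕ (suc P) f                           ≈⟨ detℕ-expand-lastRow P f ⟩
    sumℕ (suc P) (laplaceTerm P f)           ≈⟨ sumℕ-snoc P (laplaceTerm P f) ⟩
    sumℕ P (laplaceTerm P f) + laplaceTerm P f P   ≈⟨ +-comm _ _ ⟩
    laplaceTerm P f P + sumℕ P (laplaceTerm P f)
      ≈⟨ +-cong corner (sumℕ-cong P (laplaceTerm≈expansionTerm P f)) ⟩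
    expansionTerm P g 0 + sumℕ P (λ j → expansionTerm P g (suc j))   ≈⟨ ≈-sym (detℕ-expand P g) ⟩
    detℕ (suc P) g                           ∎
    where
    g : ℕ → ℕ → A
    g = lastToFront P f
    corner : laplaceTerm P f P ≈ expansionTerm P g 0
    corner rewrite ℕ.n∸n≡0 P = ≈-trans (*-congˡ (≈-trans (*-identityˡ _)
      (detℕ-cong P (λ a b _ b<P → reflexive (cong (f a) (punchInℕ-< b<P)))))) (≈-sym (*-identityˡ _))

  detℕ-bordered-unit : ∀ P c f → detℕ (suc P) (bordered 1# (λ _ → 0#) c f) ≈ detℕ P f
  detℕ-bordered-unit P c f = begin
    detℕ (suc P) g                                         ≈⟨ detℕ-expand P g ⟩
    expansionTerm P g 0 + sumℕ P (λ j → expansionTerm P g (suc j))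
      ≈⟨ +-cong (≈-trans (*-identityˡ _) (*-identityˡ _)) (sumℕ-zero P (λ j → expansionTerm P g (suc j)) (λ _ _ → ≈-trans (*-congˡ (zeroˡ _)) (zeroʳ _))) ⟩
    detℕ P f + 0#                                          ≈⟨ +-identityʳ _ ⟩
    detℕ P f                                               ∎
    where
    g : ℕ → ℕ → A
    g = bordered 1# (λ _ → 0#) c f

  detℕ-bordered : ∀ P d α β u f →
    detℕ (suc P) (bordered d (λ j → α * u j) (λ i → β * u i) f) ≈ d * detℕ P f + (α * β) * detℕ (suc P) (bordered 0# u u f)
  detℕ-bordered P d α β u f = begin
    detℕ (suc P) (bordered d (λ j → α * u j) (λ i → β * u i) f)
      ≈⟨ detℕ-linear-row (suc P) 0 (s≤s z≤n) d α (bordered d (λ j → α * u j) (λ i → β * u i) f) unit half other-rows other-rows first-row ⟩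
    d * detℕ (suc P) unit + α * detℕ (suc P) half
      ≈⟨ +-cong (*-congˡ (detℕ-bordered-unit P (λ i → β * u i) f)) (*-congˡ half-linear) ⟩
    d * detℕ P f + α * (β * Z)   ≈⟨ +-congˡ (≈-sym (*-assoc α β Z)) ⟩
    d * detℕ P f + (α * β) * Z   ∎
    where
    unit : ℕ → ℕ → A
    unit = bordered 1# (λ _ → 0#) (λ i → β * u i) f
    half : ℕ → ℕ → A
    half = bordered 0# u (λ i → β * u i) f
    Z : A
    Z = detℕ (suc P) (bordered 0# u u f)
    other-rows : ∀ {d′ r′} i j → i ≢ 0 → bordered d (λ j → α * u j) (λ i → β * u i) f i j ≈ bordered d′ r′ (λ i → β * u i) f i j
    other-rows zero _ 0≢0 = ⊥-elim (0≢0 refl)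
    other-rows (suc i) zero _ = ≈-refl
    other-rows (suc i) (suc j) _ = ≈-refl
    first-row : ∀ j → bordered d (λ j → α * u j) (λ i → β * u i) f 0 j ≈ d * unit 0 j + α * half 0 j
    first-row zero = ≈-sym (≈-trans (+-cong (*-identityʳ d) (zeroʳ α)) (+-identityʳ d))
    first-row (suc j) = ≈-sym (≈-trans (+-congʳ (zeroʳ d)) (+-identityˡ _))
    first-column : ∀ i → half i 0 ≈ β * bordered 0# u u f i 0 + 0# * bordered 0# u u f i 0
    first-column zero = ≈-sym (≈-trans (+-cong (zeroʳ β) (zeroˡ _)) (+-identityʳ 0#))
    first-column (suc i) = ≈-sym (≈-trans (+-congˡ (zeroˡ _)) (+-identityʳ _))
    other-columns : ∀ i j → j ≢ 0 → half i j ≈ bordered 0# u u f i j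
    other-columns i zero 0≢0 = ⊥-elim (0≢0 refl)
    other-columns zero (suc j) _ = ≈-refl
    other-columns (suc i) (suc j) _ = ≈-refl
    half-linear : detℕ (suc P) half ≈ β * Z
    half-linear = ≈-trans (detℕ-linear-column (suc P) 0 (s≤s z≤n) β 0# half (bordered 0# u u f) (bordered 0# u u f) other-columns other-columns first-column)
      (≈-trans (+-congˡ (zeroˡ _)) (+-identityʳ _))

  *-neg-* : ∀ d a x → d * (- a * x) ≈ - (d * (a * x))
  *-neg-* d a x = ≈-trans (*-congˡ (≈-sym (-‿distribˡ-* a x))) (≈-sym (-‿distribʳ-* d (a * x)))

  +-cancel-three : ∀ g x y z → (((g + (x + (y + z))) + - x) + - y) + - z ≈ g
  +-cancel-three g x y z = begin
    (((g + (x + (y + z))) + - x) + - y) + - z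
      ≈⟨ solve 7 (λ g x y z x′ y′ z′ → (((g :+ (x :+ (y :+ z))) :+ x′) :+ y′) :+ z′ := g :+ ((x :+ x′) :+ ((y :+ y′) :+ (z :+ z′))))
           ≈-refl g x y z (- x) (- y) (- z) ⟩
    g + ((x + - x) + ((y + - y) + (z + - z)))
      ≈⟨ +-congˡ (≈-trans (+-cong (-‿inverseʳ x) (+-cong (-‿inverseʳ y) (-‿inverseʳ z))) (≈-trans (+-identityˡ _) (+-identityʳ 0#))) ⟩
    g + 0#   ≈⟨ +-identityʳ g ⟩
    g        ∎

  +-cancel-two : ∀ z x y → (z + (- x + - y)) + (y + x) ≈ z
  +-cancel-two z x y = begin
    (z + (- x + - y)) + (y + x)
      ≈⟨ solve 5 (λ z x y x′ y′ → (z :+ (x′ :+ y′)) :+ (y :+ x) := z :+ ((x :+ x′) :+ (y :+ y′))) ≈-refl z x y (- x) (- y) ⟩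
    z + ((x + - x) + (y + - y))   ≈⟨ +-congˡ (≈-trans (+-cong (-‿inverseʳ x) (-‿inverseʳ y)) (+-identityʳ 0#)) ⟩
    z + 0#                        ≈⟨ +-identityʳ z ⟩
    z                             ∎

  +-cancel-middle : ∀ z x y → (z + - x) + (x + y) ≈ z + y
  +-cancel-middle z x y = begin
    (z + - x) + (x + y)     ≈⟨ solve 4 (λ z x y x′ → (z :+ x′) :+ (x :+ y) := (z :+ y) :+ (x :+ x′)) ≈-refl z x y (- x) ⟩
    (z + y) + (x + - x)     ≈⟨ +-congˡ (-‿inverseʳ x) ⟩
    (z + y) + 0#            ≈⟨ +-identityʳ _ ⟩
    z + y                   ∎

  detℕ-clearLastRow-swap : ∀ N p (a : A) (M : ℕ → ℕ → A) → p < N →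
    (∀ j → j < 2 +ℕ N → M (suc N) j ≈ δ N j + a * δ p j) →
    detℕ (2 +ℕ N) M ≈ - detℕ (suc N) (λ i j → addColumn p N (- a) M i (swapℕ N j))
  detℕ-clearLastRow-swap N p a M p<N row = begin
    detℕ (2 +ℕ N) M          ≈⟨ ≈-sym (detℕ-addColumn (2 +ℕ N) p N (- a) M (ℕ.<⇒≢ p<N) (ℕ.<-trans p<N N<2+N) N<2+N) ⟩
    detℕ (2 +ℕ N) M₁         ≈⟨ ≈-sym (-‿involutive _) ⟩
    - - detℕ (2 +ℕ N) M₁     ≈⟨ -‿cong (≈-sym swapped) ⟩
    - detℕ (2 +ℕ N) M₂       ≈⟨ -‿cong (≈-trans (detℕ-lastRow (suc N) M₂ cleared) (≈-trans (*-congʳ corner) (*-identityˡ _))) ⟩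
    - detℕ (suc N) M₂        ∎
    where
    N<2+N : N < 2 +ℕ N
    N<2+N = ℕ.m<n⇒m<1+n (ℕ.n<1+n N)
    M₁ : ℕ → ℕ → A
    M₁ = addColumn p N (- a) M
    M₂ : ℕ → ℕ → A
    M₂ i j = M₁ i (swapℕ N j)
    swapped : detℕ (2 +ℕ N) M₂ ≈ - detℕ (2 +ℕ N) M₁
    swapped = detℕ-swap-adjacent-columns (2 +ℕ N) N (ℕ.n<1+n (suc N)) M₁ M₂
      (λ i → reflexive (cong (M₁ i) (swapℕ-left N))) (λ i → reflexive (cong (M₁ i) (swapℕ-right N)))
      (λ i j j≢N j≢sN → reflexive (cong (M₁ i) (swapℕ-other j≢N j≢sN)))
    last-N : M (suc N) N ≈ 1#
    last-N = ≈-trans (row N N<2+N) (≈-trans (+-cong (reflexive (δ-refl N)) (≈-trans (*-congˡ (reflexive (δ-> p<N))) (zeroʳ a)))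
      (+-identityʳ 1#))
    corner : M₂ (suc N) (suc N) ≈ 1#
    corner = begin
      M₂ (suc N) (suc N)                           ≡⟨ cong (M₁ (suc N)) (swapℕ-right N) ⟩
      M (suc N) N + δ p N * (- a * M (suc N) N)    ≈⟨ +-cong last-N (≈-trans (*-congʳ (reflexive (δ-> p<N))) (zeroˡ _)) ⟩
      1# + 0#                                      ≈⟨ +-identityʳ 1# ⟩
      1#                                           ∎
    cleared : ∀ j → j < suc N → M₂ (suc N) j ≈ 0#
    cleared j (s≤s j≤N) with ℕ.m≤n⇒m<n∨m≡n j≤N
    ... | inj₂ refl = begin
      M₂ (suc N) N                                           ≡⟨ cong (M₁ (suc N)) (swapℕ-left N) ⟩
      M (suc N) (suc N) + δ p (suc N) * (- a * M (suc N) N)   ≈⟨ +-cong (row (suc N) (ℕ.n<1+n (suc N))) (≈-trans (*-congʳ (reflexive δ-p-sN)) (zeroˡ _)) ⟩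
      (δ N (suc N) + a * δ p (suc N)) + 0#                   ≈⟨ ≈-trans (+-identityʳ _) (+-cong (reflexive (δ-> (ℕ.n<1+n N))) (≈-trans (*-congˡ (reflexive δ-p-sN)) (zeroʳ a))) ⟩
      0# + 0#                                                ≈⟨ +-identityʳ 0# ⟩
      0#                                                     ∎
      where
      δ-p-sN : δ p (suc N) ≡ 0#
      δ-p-sN = δ-> (ℕ.m<n⇒m<1+n p<N)
    ... | inj₁ j<N = begin
      M₂ (suc N) j                                 ≡⟨ cong (M₁ (suc N)) (swapℕ-other (ℕ.<⇒≢ j<N) (ℕ.<⇒≢ (ℕ.m<n⇒m<1+n j<N))) ⟩
      M (suc N) j + δ p j * (- a * M (suc N) N)    ≈⟨ +-cong (row j (ℕ.<-trans j<N N<2+N)) (*-congˡ (*-congˡ last-N)) ⟩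
      (δ N j + a * δ p j) + δ p j * (- a * 1#)     ≈⟨ +-cong (≈-trans (+-congʳ (reflexive (δ-< j<N))) (+-identityˡ _)) (*-neg-* (δ p j) a 1#) ⟩
      a * δ p j + - (δ p j * (a * 1#))             ≈⟨ +-congˡ (-‿cong (≈-trans (*-congˡ (*-identityʳ a)) (*-comm _ a))) ⟩
      a * δ p j + - (a * δ p j)                    ≈⟨ -‿inverseʳ _ ⟩
      0#                                           ∎

  detℕ-clearLastRow-subtract : ∀ N c q (M : ℕ → ℕ → A) → c < N → q < N →
    (∀ j → j < N → M N j ≈ δ c j + δ q j) → M N N ≈ 1# →
    detℕ (suc N) M ≈ detℕ N (addColumn q N (- 1#) (addColumn c N (- 1#) M))
  detℕ-clearLastRow-subtract N c q M c<N q<N row corner = begin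
    detℕ (suc N) M      ≈⟨ ≈-sym (≈-trans (detℕ-addColumn (suc N) q N (- 1#) M′ (ℕ.<⇒≢ q<N) (ℕ.m<n⇒m<1+n q<N) (ℕ.n<1+n N))
                                          (detℕ-addColumn (suc N) c N (- 1#) M (ℕ.<⇒≢ c<N) (ℕ.m<n⇒m<1+n c<N) (ℕ.n<1+n N))) ⟩
    detℕ (suc N) M″     ≈⟨ detℕ-lastRow N M″ cleared ⟩
    M″ N N * detℕ N M″  ≈⟨ ≈-trans (*-congʳ corner″) (*-identityˡ _) ⟩
    detℕ N M″           ∎
    where
    M′ : ℕ → ℕ → A
    M′ = addColumn c N (- 1#) M
    M″ : ℕ → ℕ → A
    M″ = addColumn q N (- 1#) M′
    corner′ : M′ N N ≈ 1#
    corner′ = ≈-trans (+-congˡ (≈-trans (*-congʳ (reflexive (δ-> c<N))) (zeroˡ _))) (≈-trans (+-identityʳ _) corner)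
    corner″ : M″ N N ≈ 1#
    corner″ = ≈-trans (+-congˡ (≈-trans (*-congʳ (reflexive (δ-> q<N))) (zeroˡ _))) (≈-trans (+-identityʳ _) corner′)
    minus-one : ∀ d → d * (- 1# * 1#) ≈ - d
    minus-one d = ≈-trans (*-neg-* d 1# 1#) (-‿cong (≈-trans (*-congˡ (*-identityˡ 1#)) (*-identityʳ d)))
    cleared : ∀ j → j < N → M″ N j ≈ 0#
    cleared j j<N = begin
      (M N j + δ c j * (- 1# * M N N)) + δ q j * (- 1# * M′ N N)
        ≈⟨ +-cong (+-cong (row j j<N) (*-congˡ (*-congˡ corner))) (*-congˡ (*-congˡ corner′)) ⟩
      ((δ c j + δ q j) + δ c j * (- 1# * 1#)) + δ q j * (- 1# * 1#)
        ≈⟨ +-cong (+-congˡ (minus-one (δ c j))) (minus-one (δ q j)) ⟩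
      ((δ c j + δ q j) + - δ c j) + - δ q j
        ≈⟨ solve 4 (λ x y x′ y′ → ((x :+ y) :+ x′) :+ y′ := (x :+ x′) :+ (y :+ y′)) ≈-refl (δ c j) (δ q j) (- δ c j) (- δ q j) ⟩
      (δ c j + - δ c j) + (δ q j + - δ q j)
        ≈⟨ +-cong (-‿inverseʳ _) (-‿inverseʳ _) ⟩
      0# + 0#                                      ≈⟨ +-identityʳ 0# ⟩
      0#                                           ∎

  detℕ-eliminateLastPair : ∀ N p q (a : A) (M g : ℕ → ℕ → A) → p ≤ N → q < N →
    (∀ j → j < 3 +ℕ N → M (2 +ℕ N) j ≈ δ (suc N) j + a * δ p j) →
    (∀ j → j < 3 +ℕ N → M (suc N) j ≈ (δ N j + δ q j) + δ (2 +ℕ N) j) →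
    (∀ i j → i < suc N → j < suc N →
       g i j + (δ p j * (a * M i (suc N)) + (δ N j + δ q j) * M i (2 +ℕ N)) ≈ M i j) →
    detℕ (3 +ℕ N) M ≈ - detℕ (suc N) g
  detℕ-eliminateLastPair N p q a M g p≤N q<N row-t row-s reduced = begin
    detℕ (3 +ℕ N) M       ≈⟨ detℕ-clearLastRow-swap (suc N) p a M (s≤s p≤N) row-t ⟩
    - detℕ (2 +ℕ N) M₂    ≈⟨ -‿cong (detℕ-clearLastRow-subtract (suc N) N q M₂ (ℕ.n<1+n N) (ℕ.m<n⇒m<1+n q<N) row₂ corner₂) ⟩
    - detℕ (suc N) M₃     ≈⟨ -‿cong (detℕ-cong (suc N) (λ i j i<s j<s → ≈-sym (g≈M₃ i<s j<s))) ⟩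
    - detℕ (suc N) g      ∎
    where
    s : ℕ
    s = suc N
    t : ℕ
    t = suc s
    M₁ : ℕ → ℕ → A
    M₁ = addColumn p s (- a) M
    M₂ : ℕ → ℕ → A
    M₂ i j = M₁ i (swapℕ s j)
    M₃ : ℕ → ℕ → A
    M₃ = addColumn q s (- 1#) (addColumn N s (- 1#) M₂)
    M₂-below : ∀ i {j} → j < s → M₂ i j ≡ M₁ i j
    M₂-below i j<s = cong (M₁ i) (swapℕ-other (ℕ.<⇒≢ j<s) (ℕ.<⇒≢ (ℕ.m<n⇒m<1+n j<s)))
    M₂-s : ∀ i → M₂ i s ≈ M i t
    M₂-s i = ≈-trans (reflexive (cong (M₁ i) (swapℕ-left s)))
      (≈-trans (+-congˡ (≈-trans (*-congʳ (reflexive (δ-> (s≤s (ℕ.m≤n⇒m≤1+n p≤N))))) (zeroˡ _))) (+-identityʳ _))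
    row-s-below : ∀ {j} → j < t → M s j ≈ δ N j + δ q j
    row-s-below {j} j<t = ≈-trans (row-s j (ℕ.m<n⇒m<1+n j<t))
      (≈-trans (+-congˡ (reflexive (δ-< j<t))) (+-identityʳ _))
    row₂ : ∀ j → j < s → M₂ s j ≈ δ N j + δ q j
    row₂ j j<s = begin
      M₂ s j                              ≡⟨ M₂-below s j<s ⟩
      M s j + δ p j * (- a * M s s)       ≈⟨ +-cong (row-s-below (ℕ.m<n⇒m<1+n j<s)) (*-congˡ (*-congˡ (row-s-below (ℕ.n<1+n s)))) ⟩
      (δ N j + δ q j) + δ p j * (- a * (δ N s + δ q s))
        ≈⟨ +-congˡ (≈-trans (*-congˡ (≈-trans (*-congˡ (≈-trans (+-cong (reflexive (δ-> (ℕ.n<1+n N))) (reflexive (δ-> (ℕ.m<n⇒m<1+n q<N)))) (+-identityʳ 0#))) (zeroʳ _))) (zeroʳ _)) ⟩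
      (δ N j + δ q j) + 0#                ≈⟨ +-identityʳ _ ⟩
      δ N j + δ q j                       ∎
    corner₂ : M₂ s s ≈ 1#
    corner₂ = ≈-trans (M₂-s s) (≈-trans (row-s t (ℕ.n<1+n t))
      (≈-trans (+-cong (+-cong (reflexive (δ-> (ℕ.m<n⇒m<1+n (ℕ.n<1+n N)))) (reflexive (δ-> (ℕ.<-trans q<N (ℕ.m<n⇒m<1+n (ℕ.n<1+n N))))))
                       (reflexive (δ-refl t)))
               (≈-trans (+-congʳ (+-identityʳ 0#)) (+-identityˡ 1#))))
    g≈M₃ : ∀ {i j} → i < s → j < s → g i j ≈ M₃ i j
    g≈M₃ {i} {j} i<s j<s = ≈-sym (begin
      (M₂ i j + δ N j * (- 1# * M₂ i s)) + δ q j * (- 1# * (M₂ i s + δ N s * (- 1# * M₂ i s)))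
        ≈⟨ +-cong (+-cong (reflexive (M₂-below i j<s)) (*-congˡ (*-congˡ (M₂-s i))))
                  (*-congˡ (*-congˡ (≈-trans (+-congˡ (≈-trans (*-congʳ (reflexive (δ-> (ℕ.n<1+n N)))) (zeroˡ _))) (≈-trans (+-identityʳ _) (M₂-s i))))) ⟩
      ((M i j + δ p j * (- a * M i s)) + δ N j * (- 1# * M i t)) + δ q j * (- 1# * M i t)
        ≈⟨ +-cong (+-cong (+-congˡ (*-neg-* (δ p j) a _)) (*-neg-* (δ N j) 1# _)) (*-neg-* (δ q j) 1# _) ⟩
      ((M i j + - x) + - (δ N j * (1# * M i t))) + - (δ q j * (1# * M i t))
        ≈⟨ +-cong (+-cong (+-congʳ Mij≈) (-‿cong (*-congˡ (*-identityˡ _)))) (-‿cong (*-congˡ (*-identityˡ _))) ⟩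
      ((g i j + (x + (y + z))) + - x) + - y + - z
        ≈⟨ +-cancel-three (g i j) x y z ⟩
      g i j ∎)
      where
      x : A
      x = δ p j * (a * M i s)
      y : A
      y = δ N j * M i t
      z : A
      z = δ q j * M i t
      Mij≈ : M i j ≈ g i j + (x + (y + z))
      Mij≈ = ≈-trans (≈-sym (reduced i j i<s j<s)) (+-congˡ (+-congˡ (distribʳ (M i t) (δ N j) (δ q j))))

twice : ℕ → ℕ
twice zero = zero
twice (suc k) = suc (suc (twice k))

2*≡twice : ∀ m → 2 *ℕ m ≡ twice m
2*≡twice zero = refl
2*≡twice (suc m) = trans (cong suc (ℕ.+-suc m (m +ℕ 0))) (cong (λ z → suc (suc z)) (2*≡twice m))

twice-mono-≤ : ∀ {k m} → k ≤ m → twice k ≤ twice m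
twice-mono-≤ z≤n = z≤n
twice-mono-≤ (s≤s k≤m) = s≤s (s≤s (twice-mono-≤ k≤m))

evenᵇ-twice : ∀ k → evenᵇ (twice k) ≡ true
evenᵇ-twice zero = refl
evenᵇ-twice (suc k) = evenᵇ-twice k

evenᵇ-suc-twice : ∀ k → evenᵇ (suc (twice k)) ≡ false
evenᵇ-suc-twice zero = refl
evenᵇ-suc-twice (suc k) = evenᵇ-suc-twice k

square-suc : ∀ m → suc m *ℕ suc m ≡ suc (m *ℕ m +ℕ twice m)
square-suc m = cong suc (trans (cong (m +ℕ_) (ℕ.*-suc m m))
  (trans (sym (ℕ.+-assoc m m (m *ℕ m))) (trans (ℕ.+-comm (m +ℕ m) (m *ℕ m))
    (cong (m *ℕ m +ℕ_) (trans (cong (m +ℕ_) (sym (ℕ.+-identityʳ m))) (2*≡twice m))))))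

data Block (P : ℕ) : ℕ → Set where
  upper : ∀ {i} → i < P → Block P i
  lower : ∀ t → Block P (P +ℕ t)

block : ∀ P i → Block P i
block P i with i ℕ.<? P
... | yes i<P = upper i<P
... | no i≮P = subst (Block P) (ℕ.m+[n∸m]≡n (ℕ.≮⇒≥ i≮P)) (lower (i ∸ P))

lower-bound : ∀ {P t L} → P +ℕ t < suc (P +ℕ L) → t ≤ L
lower-bound {P} {t} {L} (s≤s P+t≤P+L) = ℕ.+-cancelˡ-≤ P t L P+t≤P+L

pos-suc : ∀ i → pos (suc i) ≡ (let (m , k) = pos i in if k ≡ᵇ 2 *ℕ m then (suc m , 0) else (m , suc k))
pos-suc i with pos i
... | m , k = refl

pos-exact : ∀ m k → k ≤ twice m → pos (m *ℕ m +ℕ k) ≡ (m , k)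
pos-exact zero zero _ = refl
pos-exact (suc m) zero _ = begin
  pos (suc m *ℕ suc m +ℕ 0)          ≡⟨ cong pos (trans (ℕ.+-identityʳ _) (square-suc m)) ⟩
  pos (suc (m *ℕ m +ℕ twice m))      ≡⟨ pos-suc (m *ℕ m +ℕ twice m) ⟩
  _                                  ≡⟨ cong (λ (p : ℕ × ℕ) → let (m′ , k) = p in if k ≡ᵇ 2 *ℕ m′ then (suc m′ , 0) else (m′ , suc k))
                                          (pos-exact m (twice m) ℕ.≤-refl) ⟩
  (if twice m ≡ᵇ 2 *ℕ m then (suc m , 0) else (m , suc (twice m)))
                                     ≡⟨ cong (λ b → if b then (suc m , 0) else (m , suc (twice m))) (trans (cong (twice m ≡ᵇ_) (2*≡twice m)) (≡ᵇ-refl (twice m))) ⟩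
  (suc m , 0)                        ∎
  where open ≡-Reasoning
pos-exact m (suc k) k<2m = begin
  pos (m *ℕ m +ℕ suc k)              ≡⟨ cong pos (ℕ.+-suc (m *ℕ m) k) ⟩
  pos (suc (m *ℕ m +ℕ k))            ≡⟨ pos-suc (m *ℕ m +ℕ k) ⟩
  _                                  ≡⟨ cong (λ (p : ℕ × ℕ) → let (m′ , k′) = p in if k′ ≡ᵇ 2 *ℕ m′ then (suc m′ , 0) else (m′ , suc k′))
                                          (pos-exact m k (ℕ.<⇒≤ k<2m)) ⟩
  (if k ≡ᵇ 2 *ℕ m then (suc m , 0) else (m , suc k))
                                     ≡⟨ cong (λ b → if b then (suc m , 0) else (m , suc k)) (≢⇒≡ᵇ-false (λ e → ℕ.<⇒≢ k<2m (trans e (2*≡twice m)))) ⟩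
  (m , suc k)                        ∎
  where open ≡-Reasoning

record SquareCoordinates (i : ℕ) : Set where
  constructor coordinates
  field
    root offset : ℕ
    offset≤twice : offset ≤ twice root
    root²+offset≡ : root *ℕ root +ℕ offset ≡ i

squareCoordinates : ∀ i → SquareCoordinates i
squareCoordinates zero = coordinates 0 0 z≤n refl
squareCoordinates (suc i) with squareCoordinates i
... | coordinates m l l≤2m eq with l ≟ twice m
...   | yes refl = coordinates (suc m) 0 z≤n (trans (ℕ.+-identityʳ _) (trans (square-suc m) (cong suc eq)))
...   | no l≢2m = coordinates m (suc l) (ℕ.≤∧≢⇒< l≤2m l≢2m) (trans (ℕ.+-suc _ l) (cong suc eq))

pos-squareCoordinates : ∀ {i} (c : SquareCoordinates i) → pos i ≡ (SquareCoordinates.root c , SquareCoordinates.offset c)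
pos-squareCoordinates (coordinates m l l≤2m refl) = pos-exact m l l≤2m

root<-of-square< : ∀ {m l i k} → m *ℕ m +ℕ l ≡ i → i < k *ℕ k → m < k
root<-of-square< {m} {l} {i} {k} refl i<k² with ℕ.<-cmp m k
... | tri< m<k _ _ = m<k
... | tri≈ _ refl _ = ⊥-elim (ℕ.<-irrefl refl (ℕ.<-≤-trans i<k² (ℕ.m≤m+n (m *ℕ m) l)))
... | tri> _ _ k<m = ⊥-elim (ℕ.<-irrefl refl (ℕ.<-≤-trans i<k²
      (ℕ.≤-trans (ℕ.*-mono-≤ (ℕ.<⇒≤ k<m) (ℕ.<⇒≤ k<m)) (ℕ.m≤m+n (m *ℕ m) l))))

square+offset< : ∀ {m l k} → m < k → l ≤ twice m → m *ℕ m +ℕ l < k *ℕ k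
square+offset< {m} {l} {k} m<k l≤2m =
  ℕ.<-≤-trans (s≤s (ℕ.+-monoʳ-≤ (m *ℕ m) l≤2m)) (subst (_≤ k *ℕ k) (square-suc m) (ℕ.*-mono-≤ m<k m<k))

blocks : ∀ {a} {X : Set a} → ℕ → (ℕ → ℕ → X) → (ℕ → ℕ → X) → (ℕ → ℕ → X) → (ℕ → ℕ → X) → ℕ → ℕ → X
blocks P upperLeft upperRight lowerLeft lowerRight i j =
  if i <ᵇ P then (if j <ᵇ P then upperLeft i j else upperRight i (j ∸ P))
  else (if j <ᵇ P then lowerLeft (i ∸ P) j else lowerRight (i ∸ P) (j ∸ P))

module _ {a} {X : Set a} (P : ℕ) (UL UR LL LR : ℕ → ℕ → X) where

  blocks-upper-upper : ∀ {i j} → i < P → j < P → blocks P UL UR LL LR i j ≡ UL i j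
  blocks-upper-upper i<P j<P rewrite <⇒<ᵇ-true i<P | <⇒<ᵇ-true j<P = refl

  blocks-upper-lower : ∀ {i} u → i < P → blocks P UL UR LL LR i (P +ℕ u) ≡ UR i u
  blocks-upper-lower u i<P rewrite <⇒<ᵇ-true i<P | ≥⇒<ᵇ-false (ℕ.m≤m+n P u) | ℕ.m+n∸m≡n P u = refl

  blocks-lower-upper : ∀ t {j} → j < P → blocks P UL UR LL LR (P +ℕ t) j ≡ LL t j
  blocks-lower-upper t j<P rewrite <⇒<ᵇ-true j<P | ≥⇒<ᵇ-false (ℕ.m≤m+n P t) | ℕ.m+n∸m≡n P t = refl

  blocks-lower-lower : ∀ t u → blocks P UL UR LL LR (P +ℕ t) (P +ℕ u) ≡ LR t u
  blocks-lower-lower t u rewrite ≥⇒<ᵇ-false (ℕ.m≤m+n P t) | ≥⇒<ᵇ-false (ℕ.m≤m+n P u) | ℕ.m+n∸m≡n P t | ℕ.m+n∸m≡n P u = refl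

module _ {a} {X : Set a} where

  if-false-false : ∀ {b₁ b₂} {x y z : X} → b₁ ≡ false → b₂ ≡ false → (if b₁ then x else if b₂ then y else z) ≡ z
  if-false-false refl refl = refl

  if-false-_-false : ∀ {b₁ b₂ b₃} {x y z w : X} → b₁ ≡ false → b₃ ≡ false →
    (if b₁ then x else if b₂ then y else if b₃ then z else w) ≡ (if b₂ then y else w)
  if-false-_-false {b₂ = true} refl refl = refl
  if-false-_-false {b₂ = false} refl refl = refl

module BlockTridiagonal {c ℓ : Level} (R : CommutativeRing c ℓ) where
  open CommutativeRing R hiding (zero) renaming (Carrier to A; refl to ≈-refl; sym to ≈-sym; trans to ≈-trans)
  open import Relation.Binary.Reasoning.Setoid setoid
  open Determinant R
  open import Algebra.Properties.Ring ring using (-‿distribˡ-*; -‿distribʳ-*)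
  open import Algebra.Solver.Ring.NaturalCoefficients.Default commutativeSemiring using (solve; _:+_; _:*_; _:=_)

  δ-1-2*suc : ∀ {m} → δ 1 (2 *ℕ suc m) ≡ 0#
  δ-1-2*suc {m} = δ-> (subst (1 <_) (sym (2*≡twice (suc m))) (s≤s (s≤s z≤n)))

  -- T_m(a, b) for L = 2m written with Kronecker deltas; for L = 0 it is the 1×1 matrix a + b, as T_0 is.
  cycle : ℕ → A → A → ℕ → ℕ → A
  cycle L a b t u = (δ t (suc u) + δ u (suc t)) + ((δ t 0 * δ u L) * b + (δ t L * δ u 0) * a)

  corners-vanish : ∀ {p q} b a → p ≈ 0# → q ≈ 0# → p * b + q * a ≈ 0#
  corners-vanish b a p≈0 q≈0 =
    ≈-trans (+-cong (≈-trans (*-congʳ p≈0) (zeroˡ b)) (≈-trans (*-congʳ q≈0) (zeroˡ a))) (+-identityʳ 0#)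

  0#+0#+-identityˡ : ∀ {z} → (0# + 0#) + z ≈ z
  0#+0#+-identityˡ = ≈-trans (+-congʳ (+-identityʳ 0#)) (+-identityˡ _)

  tEntry≈cycle : ∀ (x y : ℕ → A) m t u → tEntry R x y (suc m) t u ≈ cycle (2 *ℕ suc m) (x (suc m)) (y (suc m)) t u
  tEntry≈cycle x y m zero zero =
    ≈-sym (≈-trans (+-cong (+-identityʳ 0#) (corners-vanish _ _ (zeroʳ 1#) (zeroˡ 1#))) (+-identityʳ 0#))
  tEntry≈cycle x y m zero (suc zero) rewrite δ-1-2*suc {m} =
    ≈-sym (≈-trans (+-cong (+-identityˡ 1#) (corners-vanish _ _ (zeroʳ 1#) (zeroˡ 0#))) (+-identityʳ 1#))
  tEntry≈cycle x y m zero (suc (suc u)) with suc (suc u) ≡ᵇ 2 *ℕ suc m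
  ... | true = ≈-sym (≈-trans 0#+0#+-identityˡ (≈-trans (+-cong (≈-trans (*-congʳ (*-identityˡ 1#)) (*-identityˡ _)) (≈-trans (*-congʳ (zeroˡ 0#)) (zeroˡ _))) (+-identityʳ _)))
  ... | false = ≈-sym (≈-trans 0#+0#+-identityˡ (corners-vanish _ _ (zeroʳ 1#) (zeroˡ 0#)))
  tEntry≈cycle x y m (suc zero) zero rewrite δ-1-2*suc {m} =
    ≈-sym (≈-trans (+-cong (+-identityʳ 1#) (corners-vanish _ _ (zeroˡ 0#) (zeroˡ 1#))) (+-identityʳ 1#))
  tEntry≈cycle x y m (suc (suc t)) zero with suc (suc t) ≡ᵇ 2 *ℕ suc m
  ... | true = ≈-sym (≈-trans 0#+0#+-identityˡ (≈-trans (+-cong (≈-trans (*-congʳ (zeroˡ 0#)) (zeroˡ _)) (≈-trans (*-congʳ (*-identityˡ 1#)) (*-identityˡ _))) (+-identityˡ _)))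
  ... | false = ≈-sym (≈-trans 0#+0#+-identityˡ (corners-vanish _ _ (zeroˡ 0#) (zeroˡ 1#)))
  tEntry≈cycle x y m (suc t) (suc u) with t ≡ᵇ suc u in t≡su | u ≡ᵇ suc t in u≡st | suc t ≡ᵇ 2 *ℕ suc m
  ... | true | true | _ = ⊥-elim (ℕ.<⇒≢ (ℕ.m<n⇒m<1+n (ℕ.n<1+n t)) (trans (≡ᵇ-true⇒≡ t≡su) (cong suc (≡ᵇ-true⇒≡ u≡st))))
  ... | true | false | _ = ≈-sym (≈-trans (+-cong (+-identityʳ 1#) (corners-vanish _ _ (zeroˡ _) (zeroʳ _))) (+-identityʳ 1#))
  ... | false | true | _ = ≈-sym (≈-trans (+-cong (+-identityˡ 1#) (corners-vanish _ _ (zeroˡ _) (zeroʳ _))) (+-identityʳ 1#))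
  ... | false | false | true = ≈-sym (≈-trans (+-cong (+-identityʳ 0#) (corners-vanish _ _ (zeroˡ _) (zeroʳ _))) (+-identityʳ 0#))
  ... | false | false | false = ≈-sym (≈-trans (+-cong (+-identityʳ 0#) (corners-vanish _ _ (zeroˡ _) (zeroʳ _))) (+-identityʳ 0#))

  alternating : ℕ → ℕ → A
  alternating zero = ualt R
  alternating (suc k) zero = 0#
  alternating (suc k) (suc zero) = 0#
  alternating (suc k) (suc (suc l)) = alternating k l

  alternating-below : ∀ k {l} → l < twice k → alternating k l ≡ 0#
  alternating-below (suc k) {zero} _ = refl
  alternating-below (suc k) {suc zero} _ = refl
  alternating-below (suc k) {suc (suc l)} (s≤s (s≤s l<2k)) = alternating-below k l<2k

  alternating-+-suc : ∀ k l → alternating k l + alternating (suc k) l ≈ δ (twice k) l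
  alternating-+-suc zero zero = +-identityʳ 1#
  alternating-+-suc zero (suc zero) = +-identityʳ 0#
  alternating-+-suc zero (suc (suc l)) = -‿inverseˡ (ualt R l)
  alternating-+-suc (suc k) zero = +-identityʳ 0#
  alternating-+-suc (suc k) (suc zero) = +-identityʳ 0#
  alternating-+-suc (suc k) (suc (suc l)) = alternating-+-suc k l

  rEntry-odd : ∀ k l → rEntry R (suc (twice k)) l ≡ δ (twice k) l
  rEntry-odd k l with twice k ≡ᵇ l in 2k≡l
  ... | true with refl ← ≡ᵇ-true⇒≡ {twice k} {l} 2k≡l rewrite evenᵇ-twice k = refl
  ... | false = refl

  rEntry-even : ∀ k l → rEntry R (suc (suc (twice k))) l ≡ 0#
  rEntry-even k l with suc (twice k) ≡ᵇ l in 2k+1≡l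
  ... | true with refl ← ≡ᵇ-true⇒≡ {suc (twice k)} {l} 2k+1≡l rewrite evenᵇ-suc-twice k = refl
  ... | false = refl

  shifted : ℕ → (ℕ → A) → ℕ → A
  shifted Q f i = if i <ᵇ Q then 0# else f (i ∸ Q)

  shifted-below : ∀ {Q} f {i} → i < Q → shifted Q f i ≡ 0#
  shifted-below f i<Q rewrite <⇒<ᵇ-true i<Q = refl

  shifted-+ : ∀ Q f l → shifted Q f (Q +ℕ l) ≡ f l
  shifted-+ Q f l rewrite ≥⇒<ᵇ-false (ℕ.m≤m+n Q l) | ℕ.m+n∸m≡n Q l = refl

  cycle-last-row : ∀ L a b {u} → u < 3 +ℕ L → cycle (2 +ℕ L) a b (2 +ℕ L) u ≈ δ (suc L) u + a * δ u 0
  cycle-last-row L a b {u} u<3+L = begin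
    (δ (suc L) u + δ u (3 +ℕ L)) + ((0# * δ u (2 +ℕ L)) * b + (δ (2 +ℕ L) (2 +ℕ L) * δ u 0) * a)
      ≈⟨ +-cong (+-congˡ (reflexive (δ-> u<3+L))) (+-cong (≈-trans (*-congʳ (zeroˡ _)) (zeroˡ b)) (*-congʳ (*-congʳ (reflexive (δ-refl (2 +ℕ L)))))) ⟩
    (δ (suc L) u + 0#) + (0# + (1# * δ u 0) * a)
      ≈⟨ +-cong (+-identityʳ _) (≈-trans (+-identityˡ _) (≈-trans (*-congʳ (*-identityˡ _)) (*-comm _ a))) ⟩
    δ (suc L) u + a * δ u 0 ∎

  cycle-penultimate-row : ∀ L a b {u} → cycle (2 +ℕ L) a b (suc L) u ≈ δ L u + δ (2 +ℕ L) u
  cycle-penultimate-row L a b {u} = begin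
    (δ L u + δ u (2 +ℕ L)) + ((0# * δ u (2 +ℕ L)) * b + (δ (suc L) (2 +ℕ L) * δ u 0) * a)
      ≈⟨ +-cong (+-congˡ (reflexive (δ-sym u (2 +ℕ L)))) (corners-vanish b a (zeroˡ _) (≈-trans (*-congʳ (reflexive (δ-> (ℕ.n<1+n (suc L))))) (zeroˡ _))) ⟩
    (δ L u + δ (2 +ℕ L) u) + 0#   ≈⟨ +-identityʳ _ ⟩
    δ L u + δ (2 +ℕ L) u ∎

  cycle-last-column : ∀ L a b {t} → t ≤ L → cycle (2 +ℕ L) a b t (2 +ℕ L) ≈ δ t 0 * b
  cycle-last-column L a b {t} t≤L = begin
    (δ t (3 +ℕ L) + δ (suc L) t) + ((δ t 0 * δ (2 +ℕ L) (2 +ℕ L)) * b + (δ t (2 +ℕ L) * 0#) * a)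
      ≈⟨ +-cong (+-cong (reflexive (δ-> (s≤s (ℕ.m≤n⇒m≤1+n (ℕ.m≤n⇒m≤1+n t≤L))))) (reflexive (δ-< (s≤s t≤L))))
                (+-cong (*-congʳ (*-congˡ (reflexive (δ-refl (2 +ℕ L))))) (≈-trans (*-congʳ (zeroʳ _)) (zeroˡ a))) ⟩
    (0# + 0#) + ((δ t 0 * 1#) * b + 0#)
      ≈⟨ ≈-trans 0#+0#+-identityˡ (≈-trans (+-identityʳ _) (*-congʳ (*-identityʳ _))) ⟩
    δ t 0 * b ∎

  cycle-penultimate-column : ∀ L a b {t} → t ≤ L → cycle (2 +ℕ L) a b t (suc L) ≈ δ L t
  cycle-penultimate-column L a b {t} t≤L = begin
    (δ t (2 +ℕ L) + δ L t) + ((δ t 0 * δ (suc L) (2 +ℕ L)) * b + (δ t (2 +ℕ L) * 0#) * a)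
      ≈⟨ +-cong (+-congʳ (reflexive (δ-> (s≤s (ℕ.m≤n⇒m≤1+n t≤L)))))
                (corners-vanish b a (≈-trans (*-congˡ (reflexive (δ-> (ℕ.n<1+n (suc L))))) (zeroʳ _)) (zeroʳ _)) ⟩
    (0# + δ L t) + 0#   ≈⟨ ≈-trans (+-identityʳ _) (+-identityˡ _) ⟩
    δ L t ∎

  cycle-shrink : ∀ L a b {t u} → t ≤ L → u ≤ L →
    cycle L (- a) (- b) t u + (δ u 0 * (a * δ t L) + δ u L * (δ t 0 * b)) ≈ cycle (2 +ℕ L) a b t u
  cycle-shrink L a b {t} {u} t≤L u≤L = begin
    (adjacent + ((δ t 0 * δ u L) * - b + (δ t L * δ u 0) * - a)) + (δ u 0 * (a * δ t L) + δ u L * (δ t 0 * b))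
      ≈⟨ +-cong (+-congˡ (+-cong (≈-sym (-‿distribʳ-* _ b)) (≈-sym (-‿distribʳ-* _ a))))
                (+-cong (solve 3 (λ s a r → s :* (a :* r) := (r :* s) :* a) ≈-refl (δ u 0) a (δ t L))
                        (solve 3 (λ q p b → q :* (p :* b) := (p :* q) :* b) ≈-refl (δ u L) (δ t 0) b)) ⟩
    (adjacent + (- ((δ t 0 * δ u L) * b) + - ((δ t L * δ u 0) * a))) + ((δ t L * δ u 0) * a + (δ t 0 * δ u L) * b)
      ≈⟨ +-cancel-two adjacent _ _ ⟩
    adjacent
      ≈⟨ ≈-sym (≈-trans (+-congˡ (corners-vanish b a (≈-trans (*-congˡ (reflexive (δ-> (s≤s (ℕ.m≤n⇒m≤1+n u≤L))))) (zeroʳ _))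
                                                    (≈-trans (*-congʳ (reflexive (δ-> (s≤s (ℕ.m≤n⇒m≤1+n t≤L))))) (zeroˡ _))))
                        (+-identityʳ _)) ⟩
    cycle (2 +ℕ L) a b t u ∎
    where
    adjacent : A
    adjacent = δ t (suc u) + δ u (suc t)

  border-shift : ∀ c d a v w e → v + w ≈ e → (c + d * (- a * v)) + d * (a * e) ≈ c + d * (a * w)
  border-shift c d a v w e v+w≈e = begin
    (c + d * (- a * v)) + d * (a * e)
      ≈⟨ +-cong (+-congˡ (*-neg-* d a v)) (*-congˡ (*-congˡ (≈-sym v+w≈e))) ⟩
    (c + - (d * (a * v))) + d * (a * (v + w))
      ≈⟨ +-congˡ (solve 4 (λ d a v w → d :* (a :* (v :+ w)) := d :* (a :* v) :+ d :* (a :* w)) ≈-refl d a v w) ⟩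
    (c + - (d * (a * v))) + (d * (a * v) + d * (a * w))
      ≈⟨ +-cancel-middle c _ _ ⟩
    c + d * (a * w) ∎

  module Reduction (n′ : ℕ) (x y : ℕ → A) where
    n P Q : ℕ
    n = suc n′
    P = n *ℕ n
    Q = n′ *ℕ n′

    Q+2k<P : ∀ {k} → k ≤ n′ → Q +ℕ twice k < P
    Q+2k<P {k} k≤n′ = subst (Q +ℕ twice k <_) (sym (square-suc n′)) (s≤s (ℕ.+-monoʳ-≤ Q (twice-mono-≤ k≤n′)))

    -- U_n shifted by 2k positions; V 0 is U n.
    V : ℕ → ℕ → A
    V k = shifted Q (alternating k)

    coupling : ℕ → ℕ → A
    coupling u = shifted Q (rEntry R u)

    upperRight : ℕ → A → ℕ → ℕ → A
    upperRight k a i u = coupling u i + δ u 0 * (a * V k i)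

    lowerLeft : ℕ → A → ℕ → ℕ → A
    lowerLeft k b t j = coupling t j + δ t 0 * (b * V k j)

    withCycle : ℕ → A → A → ℕ → ℕ → A
    withCycle k a b = blocks P (hEntry R x y) (upperRight k a) (lowerLeft k b) (cycle (twice k) a b)

    withCycle-upper-upper : ∀ k a b {i j} → i < P → j < P → withCycle k a b i j ≡ hEntry R x y i j
    withCycle-upper-upper k a b = blocks-upper-upper P (hEntry R x y) (upperRight k a) (lowerLeft k b) (cycle (twice k) a b)

    withCycle-upper-lower : ∀ k a b {i} u → i < P → withCycle k a b i (P +ℕ u) ≡ upperRight k a i u
    withCycle-upper-lower k a b = blocks-upper-lower P (hEntry R x y) (upperRight k a) (lowerLeft k b) (cycle (twice k) a b)

    withCycle-lower-upper : ∀ k a b t {j} → j < P → withCycle k a b (P +ℕ t) j ≡ lowerLeft k b t j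
    withCycle-lower-upper k a b = blocks-lower-upper P (hEntry R x y) (upperRight k a) (lowerLeft k b) (cycle (twice k) a b)

    withCycle-lower-lower : ∀ k a b t u → withCycle k a b (P +ℕ t) (P +ℕ u) ≡ cycle (twice k) a b t u
    withCycle-lower-lower k a b = blocks-lower-lower P (hEntry R x y) (upperRight k a) (lowerLeft k b) (cycle (twice k) a b)

    V-+-suc : ∀ k i → V k i + V (suc k) i ≈ δ (Q +ℕ twice k) i
    V-+-suc k i with block Q i
    ... | upper i<Q rewrite shifted-below (alternating k) i<Q | shifted-below (alternating (suc k)) i<Q
                          | δ-< (ℕ.<-≤-trans i<Q (ℕ.m≤m+n Q (twice k))) = +-identityʳ 0#
    ... | lower l rewrite shifted-+ Q (alternating k) l | shifted-+ Q (alternating (suc k)) l | δ-+ Q (twice k) l =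
      alternating-+-suc k l

    coupling-odd : ∀ k i → coupling (suc (twice k)) i ≡ δ (Q +ℕ twice k) i
    coupling-odd k i with block Q i
    ... | upper i<Q rewrite shifted-below (rEntry R (suc (twice k))) i<Q = sym (δ-< (ℕ.<-≤-trans i<Q (ℕ.m≤m+n Q (twice k))))
    ... | lower l rewrite shifted-+ Q (rEntry R (suc (twice k))) l | δ-+ Q (twice k) l = rEntry-odd k l

    coupling-even : ∀ k i → coupling (suc (suc (twice k))) i ≡ 0#
    coupling-even k i with block Q i
    ... | upper i<Q = shifted-below (rEntry R (suc (suc (twice k)))) i<Q
    ... | lower l rewrite shifted-+ Q (rEntry R (suc (suc (twice k)))) l = rEntry-even k l


    module _ {k : ℕ} (k≤n′ : k ≤ n′) (a b : A) where
      private
        L : ℕ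
        L = twice k
        M : ℕ → ℕ → A
        M = withCycle (suc k) a b
        Q+L<P : Q +ℕ L < P
        Q+L<P = Q+2k<P k≤n′
        P≤P+ : ∀ u → P ≤ P +ℕ u
        P≤P+ = ℕ.m≤m+n P
        s≡ : suc (P +ℕ L) ≡ P +ℕ suc L
        s≡ = sym (ℕ.+-suc P L)
        t≡ : suc (suc (P +ℕ L)) ≡ P +ℕ suc (suc L)
        t≡ = trans (cong suc s≡) (sym (ℕ.+-suc P (suc L)))
        δ-Q+L-lower : ∀ t → δ (Q +ℕ L) (P +ℕ t) ≡ 0#
        δ-Q+L-lower t = δ-> (ℕ.<-≤-trans Q+L<P (P≤P+ t))

      withCycle-column-s : ∀ i → i < suc (P +ℕ L) → M i (suc (P +ℕ L)) ≈ δ (Q +ℕ L) i + δ (P +ℕ L) i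
      withCycle-column-s i i<s with block P i
      ... | upper i<P = begin
        M i (suc (P +ℕ L))                                    ≡⟨ trans (cong (M i) s≡) (withCycle-upper-lower (suc k) a b (suc L) i<P) ⟩
        coupling (suc L) i + δ (suc L) 0 * (a * V (suc k) i)  ≈⟨ +-cong (reflexive (coupling-odd k i)) (zeroˡ _) ⟩
        δ (Q +ℕ L) i + 0#                                     ≡⟨ cong (δ (Q +ℕ L) i +_) (sym (δ-< (ℕ.<-≤-trans i<P (P≤P+ L)))) ⟩
        δ (Q +ℕ L) i + δ (P +ℕ L) i                           ∎
      ... | lower t = begin
        M (P +ℕ t) (suc (P +ℕ L))          ≡⟨ trans (cong (M (P +ℕ t)) s≡) (withCycle-lower-lower (suc k) a b t (suc L)) ⟩
        cycle (2 +ℕ L) a b t (suc L)       ≈⟨ cycle-penultimate-column L a b (lower-bound i<s) ⟩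
        δ L t                              ≈⟨ ≈-sym (+-identityˡ _) ⟩
        0# + δ L t                         ≡⟨ cong₂ _+_ (sym (δ-Q+L-lower t)) (sym (δ-+ P L t)) ⟩
        δ (Q +ℕ L) (P +ℕ t) + δ (P +ℕ L) (P +ℕ t) ∎

      withCycle-column-t : ∀ i → i < suc (P +ℕ L) → M i (suc (suc (P +ℕ L))) ≈ δ P i * b
      withCycle-column-t i i<s with block P i
      ... | upper i<P = begin
        M i (suc (suc (P +ℕ L)))                                    ≡⟨ trans (cong (M i) t≡) (withCycle-upper-lower (suc k) a b (suc (suc L)) i<P) ⟩
        coupling (2 +ℕ L) i + δ (2 +ℕ L) 0 * (a * V (suc k) i)      ≈⟨ +-cong (reflexive (coupling-even k i)) (zeroˡ _) ⟩
        0# + 0#                                                     ≈⟨ +-identityʳ 0# ⟩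
        0#                                                          ≈⟨ ≈-sym (zeroˡ b) ⟩
        0# * b                                                      ≡⟨ cong (_* b) (sym (δ-< i<P)) ⟩
        δ P i * b                                                   ∎
      ... | lower t = begin
        M (P +ℕ t) (suc (suc (P +ℕ L)))    ≡⟨ trans (cong (M (P +ℕ t)) t≡) (withCycle-lower-lower (suc k) a b t (suc (suc L))) ⟩
        cycle (2 +ℕ L) a b t (2 +ℕ L)      ≈⟨ cycle-last-column L a b (lower-bound i<s) ⟩
        δ t 0 * b                          ≡⟨ cong (_* b) (sym (δ-+ˡ P t)) ⟩
        δ P (P +ℕ t) * b                   ∎

      withCycle-row-t : ∀ j → j < 3 +ℕ (P +ℕ L) → M (suc (suc (P +ℕ L))) j ≈ δ (suc (P +ℕ L)) j + a * δ P j
      withCycle-row-t j j<3+N with block P j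
      ... | upper j<P = begin
        M (suc (suc (P +ℕ L))) j                               ≡⟨ trans (cong (λ i → M i j) t≡) (withCycle-lower-upper (suc k) a b (suc (suc L)) j<P) ⟩
        coupling (2 +ℕ L) j + δ (2 +ℕ L) 0 * (b * V (suc k) j) ≈⟨ +-cong (reflexive (coupling-even k j)) (zeroˡ _) ⟩
        0# + 0#                                                ≈⟨ +-congˡ (≈-sym (zeroʳ a)) ⟩
        0# + a * 0#                                            ≡⟨ cong₂ (λ d e → d + a * e) (sym (δ-< (ℕ.<-≤-trans j<P (ℕ.m≤n⇒m≤1+n (P≤P+ L))))) (sym (δ-< j<P)) ⟩
        δ (suc (P +ℕ L)) j + a * δ P j                         ∎
      ... | lower u = begin
        M (suc (suc (P +ℕ L))) (P +ℕ u)      ≡⟨ trans (cong (λ i → M i (P +ℕ u)) t≡) (withCycle-lower-lower (suc k) a b (suc (suc L)) u) ⟩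
        cycle (2 +ℕ L) a b (2 +ℕ L) u        ≈⟨ cycle-last-row L a b (ℕ.+-cancelˡ-< P u (3 +ℕ L) (subst (P +ℕ u <_) plus-three j<3+N)) ⟩
        δ (suc L) u + a * δ u 0              ≡⟨ cong₂ (λ d e → d + a * e) (trans (sym (δ-+ P (suc L) u)) (cong (λ i → δ i (P +ℕ u)) (sym s≡))) (sym (δ-+ˡ P u)) ⟩
        δ (suc (P +ℕ L)) (P +ℕ u) + a * δ P (P +ℕ u) ∎
        where
        plus-three : 3 +ℕ (P +ℕ L) ≡ P +ℕ (3 +ℕ L)
        plus-three = trans (cong suc t≡) (sym (ℕ.+-suc P (suc (suc L))))

      withCycle-row-s : ∀ j → j < 3 +ℕ (P +ℕ L) → M (suc (P +ℕ L)) j ≈ (δ (P +ℕ L) j + δ (Q +ℕ L) j) + δ (suc (suc (P +ℕ L))) j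
      withCycle-row-s j j<3+N with block P j
      ... | upper j<P = begin
        M (suc (P +ℕ L)) j                                   ≡⟨ trans (cong (λ i → M i j) s≡) (withCycle-lower-upper (suc k) a b (suc L) j<P) ⟩
        coupling (suc L) j + δ (suc L) 0 * (b * V (suc k) j) ≈⟨ +-cong (reflexive (coupling-odd k j)) (zeroˡ _) ⟩
        δ (Q +ℕ L) j + 0#                                    ≈⟨ +-congʳ (≈-sym (+-identityˡ _)) ⟩
        (0# + δ (Q +ℕ L) j) + 0#                             ≡⟨ cong₂ (λ d e → (d + δ (Q +ℕ L) j) + e) (sym (δ-< (ℕ.<-≤-trans j<P (P≤P+ L))))
                                                                    (sym (δ-< (ℕ.<-≤-trans j<P (ℕ.m≤n⇒m≤1+n (ℕ.m≤n⇒m≤1+n (P≤P+ L)))))) ⟩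
        (δ (P +ℕ L) j + δ (Q +ℕ L) j) + δ (suc (suc (P +ℕ L))) j ∎
      ... | lower u = begin
        M (suc (P +ℕ L)) (P +ℕ u)            ≡⟨ trans (cong (λ i → M i (P +ℕ u)) s≡) (withCycle-lower-lower (suc k) a b (suc L) u) ⟩
        cycle (2 +ℕ L) a b (suc L) u         ≈⟨ cycle-penultimate-row L a b ⟩
        δ L u + δ (2 +ℕ L) u                 ≈⟨ +-congʳ (≈-sym (+-identityʳ _)) ⟩
        (δ L u + 0#) + δ (2 +ℕ L) u          ≡⟨ cong₃ (sym (δ-+ P L u)) (sym (δ-Q+L-lower u)) (trans (sym (δ-+ P (2 +ℕ L) u)) (cong (λ i → δ i (P +ℕ u)) (sym t≡))) ⟩
        (δ (P +ℕ L) (P +ℕ u) + δ (Q +ℕ L) (P +ℕ u)) + δ (suc (suc (P +ℕ L))) (P +ℕ u) ∎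
        where
        cong₃ : ∀ {d d′ e e′ f f′} → d ≡ d′ → e ≡ e′ → f ≡ f′ → (d + e) + f ≡ (d′ + e′) + f′
        cong₃ refl refl refl = refl

      private
        correction : ℕ → ℕ → A
        correction i j = δ P j * (a * (δ (Q +ℕ L) i + δ (P +ℕ L) i)) + (δ (P +ℕ L) j + δ (Q +ℕ L) j) * (δ P i * b)

        reduces-blockwise : ∀ i j → i < suc (P +ℕ L) → j < suc (P +ℕ L) → withCycle k (- a) (- b) i j + correction i j ≈ M i j
        reduces-blockwise i j i<s j<s with block P i | block P j
        ... | upper i<P | upper j<P = begin
          withCycle k (- a) (- b) i j + correction i j
            ≡⟨ cong₂ (λ d e → withCycle k (- a) (- b) i j + (d * X + Y * (e * b))) (δ-< j<P) (δ-< i<P) ⟩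
          withCycle k (- a) (- b) i j + (0# * X + Y * (0# * b))
            ≈⟨ ≈-trans (+-congˡ (≈-trans (+-cong (zeroˡ X) (≈-trans (*-congˡ (zeroˡ b)) (zeroʳ Y))) (+-identityʳ 0#))) (+-identityʳ _) ⟩
          withCycle k (- a) (- b) i j
            ≡⟨ trans (withCycle-upper-upper k (- a) (- b) i<P j<P) (sym (withCycle-upper-upper (suc k) a b i<P j<P)) ⟩
          M i j ∎
          where
          X : A
          X = a * (δ (Q +ℕ L) i + δ (P +ℕ L) i)
          Y : A
          Y = δ (P +ℕ L) j + δ (Q +ℕ L) j
        ... | upper i<P | lower u = begin
          withCycle k (- a) (- b) i (P +ℕ u) + correction i (P +ℕ u)
            ≡⟨ cong₂ _+_ (withCycle-upper-lower k (- a) (- b) u i<P)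
                 (cong₂ (λ d e → d * (a * (δ (Q +ℕ L) i + e)) + (δ (P +ℕ L) (P +ℕ u) + δ (Q +ℕ L) (P +ℕ u)) * (δ P i * b))
                        (δ-+ˡ P u) (δ-< (ℕ.<-≤-trans i<P (P≤P+ L)))) ⟩
          upperRight k (- a) i u + (δ u 0 * (a * (δ (Q +ℕ L) i + 0#)) + (δ (P +ℕ L) (P +ℕ u) + δ (Q +ℕ L) (P +ℕ u)) * (δ P i * b))
            ≈⟨ +-congˡ (≈-trans (+-cong (*-congˡ (*-congˡ (+-identityʳ _))) (≈-trans (*-congˡ (≈-trans (*-congʳ (reflexive (δ-< i<P))) (zeroˡ b))) (zeroʳ _)))
                                (+-identityʳ _)) ⟩
          upperRight k (- a) i u + δ u 0 * (a * δ (Q +ℕ L) i)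
            ≈⟨ border-shift (coupling u i) (δ u 0) a (V k i) (V (suc k) i) (δ (Q +ℕ L) i) (V-+-suc k i) ⟩
          upperRight (suc k) a i u
            ≡⟨ sym (withCycle-upper-lower (suc k) a b u i<P) ⟩
          M i (P +ℕ u) ∎
        ... | lower t | upper j<P = begin
          withCycle k (- a) (- b) (P +ℕ t) j + correction (P +ℕ t) j
            ≡⟨ cong₂ _+_ (withCycle-lower-upper k (- a) (- b) t j<P)
                 (cong₃ (δ-< j<P) (δ-< (ℕ.<-≤-trans j<P (P≤P+ L))) (δ-+ˡ P t)) ⟩
          lowerLeft k (- b) t j + (0# * (a * (δ (Q +ℕ L) (P +ℕ t) + δ (P +ℕ L) (P +ℕ t))) + (0# + δ (Q +ℕ L) j) * (δ t 0 * b))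
            ≈⟨ +-congˡ (≈-trans (+-cong (zeroˡ _) (*-congʳ (+-identityˡ _))) (≈-trans (+-identityˡ _)
                 (solve 3 (λ e d b → e :* (d :* b) := d :* (b :* e)) ≈-refl (δ (Q +ℕ L) j) (δ t 0) b))) ⟩
          lowerLeft k (- b) t j + δ t 0 * (b * δ (Q +ℕ L) j)
            ≈⟨ border-shift (coupling t j) (δ t 0) b (V k j) (V (suc k) j) (δ (Q +ℕ L) j) (V-+-suc k j) ⟩
          lowerLeft (suc k) b t j
            ≡⟨ sym (withCycle-lower-upper (suc k) a b t j<P) ⟩
          M (P +ℕ t) j ∎
          where
          cong₃ : ∀ {d e f} → d ≡ 0# → e ≡ 0# → f ≡ δ t 0 →
            d * (a * (δ (Q +ℕ L) (P +ℕ t) + δ (P +ℕ L) (P +ℕ t))) + (e + δ (Q +ℕ L) j) * (f * b) ≡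
            0# * (a * (δ (Q +ℕ L) (P +ℕ t) + δ (P +ℕ L) (P +ℕ t))) + (0# + δ (Q +ℕ L) j) * (δ t 0 * b)
          cong₃ refl refl refl = refl
        ... | lower t | lower u = begin
          withCycle k (- a) (- b) (P +ℕ t) (P +ℕ u) + correction (P +ℕ t) (P +ℕ u)
            ≡⟨ cong₂ _+_ (withCycle-lower-lower k (- a) (- b) t u) values ⟩
          cycle L (- a) (- b) t u + (δ u 0 * (a * (0# + δ t L)) + (δ u L + 0#) * (δ t 0 * b))
            ≈⟨ +-congˡ (+-cong (*-congˡ (*-congˡ (+-identityˡ _))) (*-congʳ (+-identityʳ _))) ⟩
          cycle L (- a) (- b) t u + (δ u 0 * (a * δ t L) + δ u L * (δ t 0 * b))
            ≈⟨ cycle-shrink L a b (lower-bound i<s) (lower-bound j<s) ⟩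
          cycle (2 +ℕ L) a b t u
            ≡⟨ sym (withCycle-lower-lower (suc k) a b t u) ⟩
          M (P +ℕ t) (P +ℕ u) ∎
          where
          values : correction (P +ℕ t) (P +ℕ u) ≡ δ u 0 * (a * (0# + δ t L)) + (δ u L + 0#) * (δ t 0 * b)
          values rewrite δ-+ˡ P u | δ-+ˡ P t | δ-Q+L-lower t | δ-Q+L-lower u | δ-+ P L t | δ-+ P L u | δ-sym L t | δ-sym L u = refl

      withCycle-reduces : ∀ i j → i < suc (P +ℕ L) → j < suc (P +ℕ L) →
        withCycle k (- a) (- b) i j + (δ P j * (a * M i (suc (P +ℕ L))) + (δ (P +ℕ L) j + δ (Q +ℕ L) j) * M i (suc (suc (P +ℕ L)))) ≈ M i j
      withCycle-reduces i j i<s j<s = ≈-trans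
        (+-congˡ (+-cong (*-congˡ (*-congˡ (withCycle-column-s i i<s))) (*-congˡ (withCycle-column-t i i<s))))
        (reduces-blockwise i j i<s j<s)

      detℕ-withCycle-step : detℕ (suc (P +ℕ twice (suc k))) (withCycle (suc k) a b) ≈ - detℕ (suc (P +ℕ twice k)) (withCycle k (- a) (- b))
      detℕ-withCycle-step = begin
        detℕ (suc (P +ℕ twice (suc k))) M   ≡⟨ cong (λ N → detℕ N M) size ⟩
        detℕ (3 +ℕ (P +ℕ L)) M              ≈⟨ eliminated ⟩
        - detℕ (suc (P +ℕ L)) (withCycle k (- a) (- b)) ∎
        where
        size : suc (P +ℕ suc (suc L)) ≡ 3 +ℕ (P +ℕ L)
        size = cong suc (sym t≡)
        eliminated : detℕ (3 +ℕ (P +ℕ L)) M ≈ - detℕ (suc (P +ℕ L)) (withCycle k (- a) (- b))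
        eliminated = detℕ-eliminateLastPair (P +ℕ L) P (Q +ℕ L) a M (withCycle k (- a) (- b)) (P≤P+ L) (ℕ.<-≤-trans Q+L<P (P≤P+ L))
          withCycle-row-t withCycle-row-s withCycle-reduces

    V-below-P : ∀ {i} → i < P → V n i ≡ 0#
    V-below-P {i} i<P with block Q i
    ... | upper i<Q = shifted-below (alternating n) i<Q
    ... | lower l = trans (shifted-+ Q (alternating n) l) (alternating-below n l<2n)
      where
      l<2n : l < twice n
      l<2n = ℕ.m<n⇒m<1+n (ℕ.+-cancelˡ-< Q l (suc (twice n′)) (subst (Q +ℕ l <_) (trans (square-suc n′) (sym (ℕ.+-suc Q (twice n′)))) i<P))

    coupling-coordinates : ∀ u {m l i} → m *ℕ m +ℕ l ≡ i → l ≤ twice m → m < n →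
      coupling u i ≡ (if m ≡ᵇ n′ then rEntry R u l else 0#)
    coupling-coordinates u {m} {l} refl l≤2m m<n with m ≟ n′
    ... | yes refl rewrite ≡ᵇ-refl m = shifted-+ Q (rEntry R u) l
    ... | no m≢n′ rewrite ≢⇒≡ᵇ-false m≢n′ = shifted-below (rEntry R u) (square+offset< (ℕ.≤∧≢⇒< (ℕ.≤-pred m<n) m≢n′) l≤2m)

    border-vanishes : ∀ {i} c d a → i < P → c + d * (a * V n i) ≈ c
    border-vanishes c d a i<P = ≈-trans (+-congˡ (≈-trans (*-congˡ (≈-trans (*-congˡ (reflexive (V-below-P i<P))) (zeroʳ a))) (zeroʳ d))) (+-identityʳ c)

    hEntry-upper-lower : ∀ {i} u → i < P → u ≤ twice n → hEntry R x y i (P +ℕ u) ≈ upperRight n (x n) i u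
    hEntry-upper-lower {i} u i<P u≤2n with squareCoordinates i
    ... | c@(coordinates m l l≤2m eq) with root<-of-square< eq i<P
    ... | m<n rewrite pos-squareCoordinates c | pos-exact n u u≤2n =
      ≈-trans (reflexive (trans (if-false-false (≢⇒≡ᵇ-false (ℕ.<⇒≢ m<n)) (≢⇒≡ᵇ-false (ℕ.<⇒≢ (ℕ.m<n⇒m<1+n m<n))))
                          (sym (coupling-coordinates u eq l≤2m m<n))))
              (≈-sym (border-vanishes (coupling u i) (δ u 0) (x n) i<P))

    hEntry-lower-upper : ∀ t {j} → j < P → t ≤ twice n → hEntry R x y (P +ℕ t) j ≈ lowerLeft n (y n) t j
    hEntry-lower-upper t {j} j<P t≤2n with squareCoordinates j
    ... | c@(coordinates m l l≤2m eq) with root<-of-square< eq j<P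
    ... | m<n rewrite pos-exact n t t≤2n | pos-squareCoordinates c =
      ≈-trans (reflexive (trans (if-false-_-false {b₂ = n′ ≡ᵇ m} (≢⇒≡ᵇ-false (λ e → ℕ.<⇒≢ m<n (sym e))) (≢⇒≡ᵇ-false (λ e → ℕ.<⇒≢ (ℕ.m<n⇒m<1+n m<n) (sym e))))
                   (trans (cong (λ b → if b then rEntry R t l else 0#) (≡ᵇ-sym n′ m)) (sym (coupling-coordinates t eq l≤2m m<n)))))
              (≈-sym (border-vanishes (coupling t j) (δ t 0) (y n) j<P))

    hEntry-lower-lower : ∀ t u → t ≤ twice n → u ≤ twice n → hEntry R x y (P +ℕ t) (P +ℕ u) ≈ cycle (twice n) (x n) (y n) t u
    hEntry-lower-lower t u t≤2n u≤2n rewrite pos-exact n t t≤2n | pos-exact n u u≤2n | ≡ᵇ-refl n =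
      ≈-trans (tEntry≈cycle x y n′ t u) (reflexive (cong (λ L → cycle L (x n) (y n) t u) (2*≡twice n)))

    H≈withCycle : ∀ i j → i < suc (P +ℕ twice n) → j < suc (P +ℕ twice n) → hEntry R x y i j ≈ withCycle n (x n) (y n) i j
    H≈withCycle i j i<N j<N with block P i | block P j
    ... | upper i<P | upper j<P = reflexive (sym (withCycle-upper-upper n (x n) (y n) i<P j<P))
    ... | upper i<P | lower u = ≈-trans (hEntry-upper-lower u i<P (lower-bound j<N)) (reflexive (sym (withCycle-upper-lower n (x n) (y n) u i<P)))
    ... | lower t | upper j<P = ≈-trans (hEntry-lower-upper t j<P (lower-bound i<N)) (reflexive (sym (withCycle-lower-upper n (x n) (y n) t j<P)))
    ... | lower t | lower u = ≈-trans (hEntry-lower-lower t u (lower-bound i<N) (lower-bound j<N)) (reflexive (sym (withCycle-lower-lower n (x n) (y n) t u)))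

    withCycle-cong : ∀ k {a a′ b b′} → a ≈ a′ → b ≈ b′ → ∀ i j → withCycle k a b i j ≈ withCycle k a′ b′ i j
    withCycle-cong k {a} {a′} {b} {b′} a≈a′ b≈b′ i j with block P i | block P j
    ... | upper i<P | upper j<P = reflexive (trans (withCycle-upper-upper k a b i<P j<P) (sym (withCycle-upper-upper k a′ b′ i<P j<P)))
    ... | upper i<P | lower u = ≈-trans (reflexive (withCycle-upper-lower k a b u i<P))
      (≈-trans (+-congˡ (*-congˡ (*-congʳ a≈a′))) (reflexive (sym (withCycle-upper-lower k a′ b′ u i<P))))
    ... | lower t | upper j<P = ≈-trans (reflexive (withCycle-lower-upper k a b t j<P))
      (≈-trans (+-congˡ (*-congˡ (*-congʳ b≈b′))) (reflexive (sym (withCycle-lower-upper k a′ b′ t j<P))))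
    ... | lower t | lower u = ≈-trans (reflexive (withCycle-lower-lower k a b t u))
      (≈-trans (+-congˡ (+-cong (*-congˡ b≈b′) (*-congˡ a≈a′))) (reflexive (sym (withCycle-lower-lower k a′ b′ t u))))

    detℕ-withCycle : ∀ k → k ≤ n → ∀ a b →
      detℕ (suc (P +ℕ twice k)) (withCycle k a b) ≈ sgn R k * detℕ (suc (P +ℕ 0)) (withCycle 0 (sgn R k * a) (sgn R k * b))
    detℕ-withCycle zero _ a b = ≈-trans
      (detℕ-cong (suc (P +ℕ 0)) (λ i j _ _ → withCycle-cong 0 (≈-sym (*-identityˡ a)) (≈-sym (*-identityˡ b)) i j))
      (≈-sym (*-identityˡ _))
    detℕ-withCycle (suc k) (s≤s k≤n′) a b = begin
      detℕ (suc (P +ℕ twice (suc k))) (withCycle (suc k) a b)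
        ≈⟨ detℕ-withCycle-step k≤n′ a b ⟩
      - detℕ (suc (P +ℕ twice k)) (withCycle k (- a) (- b))
        ≈⟨ -‿cong (detℕ-withCycle k (ℕ.m≤n⇒m≤1+n k≤n′) (- a) (- b)) ⟩
      - (sgn R k * detℕ (suc (P +ℕ 0)) (withCycle 0 (sgn R k * - a) (sgn R k * - b)))
        ≈⟨ -‿distribˡ-* _ _ ⟩
      sgn R (suc k) * detℕ (suc (P +ℕ 0)) (withCycle 0 (sgn R k * - a) (sgn R k * - b))
        ≈⟨ *-congˡ (detℕ-cong (suc (P +ℕ 0)) (λ i j _ _ → withCycle-cong 0 (negate-sign k a) (negate-sign k b) i j)) ⟩
      sgn R (suc k) * detℕ (suc (P +ℕ 0)) (withCycle 0 (sgn R (suc k) * a) (sgn R (suc k) * b)) ∎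

    coupling-zero : ∀ i → coupling 0 i ≈ 0#
    coupling-zero i with block Q i
    ... | upper i<Q = reflexive (shifted-below (rEntry R 0) i<Q)
    ... | lower l = reflexive (shifted-+ Q (rEntry R 0) l)

    detℕ-withCycle-zero : ∀ a b → detℕ (suc (P +ℕ 0)) (withCycle 0 a b) ≈
      (a + b) * detℕ P (hEntry R x y) + (b * a) * detℕ (suc P) (bordered 0# (U R n) (U R n) (hEntry R x y))
    detℕ-withCycle-zero a b = begin
      detℕ (suc (P +ℕ 0)) M₀                ≡⟨ cong (λ N → detℕ (suc N) M₀) (ℕ.+-identityʳ P) ⟩
      detℕ (suc P) M₀                        ≈⟨ detℕ-lastToFront P M₀ ⟩
      detℕ (suc P) (lastToFront P M₀)        ≈⟨ detℕ-cong (suc P) moved ⟩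
      detℕ (suc P) (bordered (a + b) (λ j → b * U R n j) (λ i → a * U R n i) (hEntry R x y))
        ≈⟨ detℕ-bordered P (a + b) b a (U R n) (hEntry R x y) ⟩
      (a + b) * detℕ P (hEntry R x y) + (b * a) * detℕ (suc P) (bordered 0# (U R n) (U R n) (hEntry R x y)) ∎
      where
      M₀ : ℕ → ℕ → A
      M₀ = withCycle 0 a b
      P≡P+0 : P ≡ P +ℕ 0
      P≡P+0 = sym (ℕ.+-identityʳ P)
      unit : ∀ c → (1# * 1#) * c ≈ c
      unit c = ≈-trans (*-congʳ (*-identityˡ 1#)) (*-identityˡ c)
      coupled : ∀ c i → coupling 0 i + δ 0 0 * (c * V 0 i) ≈ c * U R n i
      coupled c i = ≈-trans (+-cong (coupling-zero i) (*-identityˡ _)) (+-identityˡ _)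
      moved : ∀ i j → i < suc P → j < suc P →
        lastToFront P M₀ i j ≈ bordered (a + b) (λ j → b * U R n j) (λ i → a * U R n i) (hEntry R x y) i j
      moved zero zero _ _ = ≈-trans (reflexive (trans (cong₂ M₀ P≡P+0 P≡P+0) (withCycle-lower-lower 0 a b 0 0)))
        (≈-trans 0#+0#+-identityˡ (≈-trans (+-cong (unit b) (unit a)) (+-comm b a)))
      moved zero (suc j) _ (s≤s j<P) = ≈-trans (reflexive (trans (cong (λ i → M₀ i j) P≡P+0) (withCycle-lower-upper 0 a b 0 j<P))) (coupled b j)
      moved (suc i) zero (s≤s i<P) _ = ≈-trans (reflexive (trans (cong (M₀ i) P≡P+0) (withCycle-upper-lower 0 a b 0 i<P))) (coupled a i)
      moved (suc i) (suc j) (s≤s i<P) (s≤s j<P) = reflexive (withCycle-upper-upper 0 a b i<P j<P)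

    detℕ-H≈detℕ-Border : detℕ (suc n *ℕ suc n) (hEntry R x y) ≈ detℕ (suc (n *ℕ n)) (rhsEntry R n x y)
    detℕ-H≈detℕ-Border = begin
      detℕ (suc n *ℕ suc n) (hEntry R x y)                     ≡⟨ cong (λ N → detℕ N (hEntry R x y)) (square-suc n) ⟩
      detℕ (suc (P +ℕ twice n)) (hEntry R x y)                 ≈⟨ detℕ-cong (suc (P +ℕ twice n)) H≈withCycle ⟩
      detℕ (suc (P +ℕ twice n)) (withCycle n (x n) (y n))     ≈⟨ detℕ-withCycle n ℕ.≤-refl (x n) (y n) ⟩
      s * detℕ (suc (P +ℕ 0)) (withCycle 0 (s * x n) (s * y n)) ≈⟨ *-congˡ (detℕ-withCycle-zero (s * x n) (s * y n)) ⟩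
      s * ((s * x n + s * y n) * D + ((s * y n) * (s * x n)) * Z)
        ≈⟨ solve 5 (λ s x y D Z → s :* ((s :* x :+ s :* y) :* D :+ ((s :* y) :* (s :* x)) :* Z)
                                  := (s :* s) :* ((x :+ y) :* D :+ ((s :* x) :* y) :* Z)) ≈-refl s (x n) (y n) D Z ⟩
      (s * s) * ((x n + y n) * D + ((s * x n) * y n) * Z)      ≈⟨ ≈-trans (*-congʳ (sgn-square n)) (*-identityˡ _) ⟩
      (x n + y n) * D + ((s * x n) * y n) * Z                  ≈⟨ ≈-sym (detℕ-bordered P (x n + y n) (s * x n) (y n) (U R n) (hEntry R x y)) ⟩
      detℕ (suc P) (bordered (x n + y n) (λ j → (s * x n) * U R n j) (λ i → y n * U R n i) (hEntry R x y))
        ≈⟨ detℕ-cong (suc P) (λ i j _ _ → reflexive (bordered≡rhsEntry i j)) ⟩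
      detℕ (suc (n *ℕ n)) (rhsEntry R n x y)                   ∎
      where
      s : A
      s = sgn R n
      D : A
      D = detℕ P (hEntry R x y)
      Z : A
      Z = detℕ (suc P) (bordered 0# (U R n) (U R n) (hEntry R x y))
      bordered≡rhsEntry : ∀ i j → bordered (x n + y n) (λ j → (s * x n) * U R n j) (λ i → y n * U R n i) (hEntry R x y) i j ≡ rhsEntry R n x y i j
      bordered≡rhsEntry zero zero = refl
      bordered≡rhsEntry zero (suc j) = refl
      bordered≡rhsEntry (suc i) zero = refl
      bordered≡rhsEntry (suc i) (suc j) = refl

open import Data.Nat using (_*_)

proposition8p2 : ∀ {c ℓ : Level} (R : CommutativeRing c ℓ) (n : ℕ) → 1 ≤ n →
    (x y : ℕ → CommutativeRing.Carrier R) →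
    CommutativeRing._≈_ R (det R (suc n * suc n) (H R n x y))
                          (det R (suc (n * n)) (Border R n x y))
proposition8p2 R (suc n′) _ x y = BlockTridiagonal.Reduction.detℕ-H≈detℕ-Border R n′ x y
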